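{- Let $p$ be a sufficiently large prime and $M\ge3$ a divisor of $p-1$, and suppose that every positive integer less than $Y$ is an $M$-th power residue modulo $p$. Then $$Y\le p^{O\left(\frac{\log\log M}{\log M}\right)}.$$
   Context: An integer $n$ coprime to $p$ is an $M$-th power residue modulo $p$ if $n\equiv y^M\pmod p$ for some integer $y$. The implied constant in $O(\cdot)$ is absolute. -}

module Defs where

open import Data.Nat using (ℕ; _^_)
open import Data.Nat.Coprimality using (Coprime)
open import Data.Integer using (ℤ; +_; _-_)
open import Data.Integer.Divisibility using (_∣_)
open import Data.Product using (_×_; ∃)

-- n is an M-th power residue modulo p: gcd(n,p)=1 and n ≡ y^M (mod p) for some integer y.
-- (Taking y ∈ ℕ loses nothing: every residue class mod p has a natural representative.)
IsPowerResidue : ℕ → ℕ → ℕ → Set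
IsPowerResidue M p n = Coprime n p × ∃ λ (y : ℕ) → (+ p) ∣ ((+ n) - (+ (y ^ M)))

-- Let d = (p − 1)/M and N < Y. Every prime q ≤ N is an M-th power residue, so q^d ≡ 1 (mod p) by
-- Fermat's little theorem, hence n^d ≡ 1 for every N-smooth n; since x^d − 1 has at most d roots
-- modulo p, the number Ψ(N, p − 1) of N-smooth integers in [1, p − 1] is at most d.
--
-- On the other hand Ψ(N, x) is large. Counting pairs (q, n) with q ∣ n gives the Buchstab-type
-- inequality ∏_{A<q≤N} q^Ψ(N, x/q) ≤ x^Ψ(N, x), while Legendre's formula for N! and Chebyshev's
-- bound ∏_{q≤n} q ≤ 4^n give the Mertens-type bound ∏_{A<q≤N} q^⌊N/q⌋ ≥ 2^(N log₂ N / 16) for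
-- N = 2^ℓ, A = 2^a and 32a ≤ ℓ. By induction on k these yield Ψ(N, x) ≥ x / L k for x ≤ N A^k,
-- where L k = ∏_{1≤j≤k} 33 (j + 1).
--
-- Hence M d = p − 1 ≤ L k d, so M ≤ (33 (k + 1))^k. Choosing N ≈ Y/2, A ≈ N^(1/32) and
-- k ≈ 32 log p / log Y gives log M ≲ (log p / log Y) log log M (the case k > log M being trivial).

module Submission where

open import Defs
open import Data.Nat using (ℕ; _*_; _∸_; _≤_; _<_)
open import Data.Nat.Divisibility using (_∣_)
open import Data.Nat.Primality using (Prime)
open import Data.Nat.Logarithm using (⌊log₂_⌋; ⌈log₂_⌉)
open import Data.Product using (∃)
open import Data.Nat.Base
open import Data.Nat.Properties
open import Data.Nat.Divisibility
open import Data.Nat.DivMod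
open import Data.Nat.Coprimality using (Coprime; coprime-divisor)
import Data.Nat.Coprimality as Coprime
open import Data.Nat.Primality using (prime?; euclidsLemma; ¬prime[0]; ¬prime[1]; prime⇒irreducible; prime⇒nonZero; prime⇒nonTrivial)
open import Data.Nat.Primality.Factorisation using (factorise; PrimeFactorisation)
open import Data.Nat.ListAction using (product)
open import Data.Nat.Induction using (<-rec)
open import Data.Nat.Combinatorics using (_C_; nCk+nC[k+1]≡[n+1]C[k+1]; nCk≡nC[n∸k]; nCn≡1; k![n∸k]!∣n!)
open import Data.Nat.Combinatorics.Specification using (nCk≡n!/k![n-k]!; k>n⇒nCk≡0)
open import Data.Nat.Logarithm
open import Data.Nat.Solver using () renaming (module +-*-Solver to ℕ-Solver)
open import Data.Integer.Base as ℤ using (ℤ; +_; 0ℤ; 1ℤ)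
import Data.Integer.Properties as ℤ
import Data.Integer.Divisibility.Signed as ℤ
open import Data.Integer.Solver using () renaming (module +-*-Solver to ℤ-Solver)
open import Data.List.Relation.Unary.All using (All; []; _∷_)
open import Data.Bool.Base using (if_then_else_)
open import Data.Product.Base using (∃-syntax; _×_; _,_; proj₁; proj₂)
open import Data.Sum.Base using (_⊎_; inj₁; inj₂)
open import Data.Empty using (⊥)
open import Function.Base using (id)
open import Level using (0ℓ)
open import Relation.Nullary using (¬_; Dec; yes; no; does; contradiction)
open import Relation.Nullary.Decidable using (map′; _×-dec_; _→-dec_; dec-false)
open import Relation.Unary using (Pred; Decidable)
open import Relation.Binary.Definitions using (Tri; tri<; tri≈; tri>)
open import Relation.Binary.PropositionalEquality
open import Algebra.Properties.CommutativeSemigroup +-commutativeSemigroup using () renaming (interchange to +-interchange)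
open import Algebra.Properties.CommutativeSemigroup *-commutativeSemigroup using (x∙yz≈y∙xz) renaming (interchange to *-interchange)

^-distribʳ-* : ∀ m n k → (m * n) ^ k ≡ m ^ k * n ^ k
^-distribʳ-* m n zero    = refl
^-distribʳ-* m n (suc k) = trans (cong (m * n *_) (^-distribʳ-* m n k)) (*-interchange m n _ _)

^-monoʳ-∣ : ∀ q {j k} → j ≤ k → q ^ j ∣ q ^ k
^-monoʳ-∣ q {j} {k} j≤k = divides (q ^ (k ∸ j)) (begin
  q ^ k               ≡⟨ cong (q ^_) (m∸n+n≡m j≤k) ⟨
  q ^ (k ∸ j + j)     ≡⟨ ^-distribˡ-+-* q (k ∸ j) j ⟩
  q ^ (k ∸ j) * q ^ j ∎)
  where open ≡-Reasoning

2^-cancel-≤ : ∀ {m n} → 2 ^ m ≤ 2 ^ n → m ≤ n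
2^-cancel-≤ 2ᵐ≤2ⁿ = ≮⇒≥ (λ n<m → <⇒≱ (^-monoʳ-< 2 (s≤s (s≤s z≤n)) n<m) 2ᵐ≤2ⁿ)

m<n*suc[m/n] : ∀ m n .{{_ : NonZero n}} → m < n * suc (m / n)
m<n*suc[m/n] m n = begin-strict
  m                 ≡⟨ m≡m%n+[m/n]*n m n ⟩
  m % n + m / n * n <⟨ +-monoˡ-< (m / n * n) (m%n<n m n) ⟩
  n + m / n * n     ≡⟨ cong (_+_ n) (*-comm (m / n) n) ⟩
  n + n * (m / n)   ≡⟨ *-suc n (m / n) ⟨
  n * suc (m / n)   ∎
  where open ≤-Reasoning

m≤n*o⇒m/n≤o : ∀ {m} n {o} .{{_ : NonZero n}} → m ≤ n * o → m / n ≤ o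
m≤n*o⇒m/n≤o {m} n {o} m≤no = ≤-trans (/-monoˡ-≤ n m≤no) (≤-reflexive (trans (cong (_/ n) (*-comm n o)) (m*n/n≡m o n)))

m/n/o≡m/o/n : ∀ m n o .{{_ : NonZero n}} .{{_ : NonZero o}} → m / n / o ≡ m / o / n
m/n/o≡m/o/n m n o = trans (m/n/o≡m/[n*o] m n o) (trans (/-congʳ (*-comm n o)) (sym (m/n/o≡m/[n*o] m o n)))
  where instance
    _ = m*n≢0 n o
    _ = m*n≢0 o n

n*[1+L/a]≤128L : ∀ n a L .{{_ : NonZero a}} → n ≤ 64 * a → a ≤ L → n * suc (L / a) ≤ 128 * L
n*[1+L/a]≤128L n a L n≤64a a≤L = begin
  n * suc (L / a)           ≤⟨ *-monoˡ-≤ (suc (L / a)) n≤64a ⟩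
  64 * a * suc (L / a)      ≡⟨ solve 2 (λ a q → con 64 :* a :* (con 1 :+ q) := con 64 :* (q :* a) :+ con 64 :* a) refl a (L / a) ⟩
  64 * (L / a * a) + 64 * a ≤⟨ +-mono-≤ (*-monoʳ-≤ 64 (m/n*n≤m L a)) (*-monoʳ-≤ 64 a≤L) ⟩
  64 * L + 64 * L           ≡⟨ solve 1 (λ x → con 64 :* x :+ con 64 :* x := con 128 :* x) refl L ⟩
  128 * L                   ∎
  where
  open ℕ-Solver
  open ≤-Reasoning

-- Division without a NonZero instance, so that it applies to a bound variable (always a prime
-- below); junk value x ÷ 0 = 0.
_÷_ : ℕ → ℕ → ℕ
x ÷ zero  = 0
x ÷ suc q = x / suc q

InRange : ℕ → ℕ → ℕ → Set
InRange a n i = a ≤ i × i < a + n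

inRange-here : ∀ a n → InRange a (suc n) a
inRange-here a n = ≤-refl , m<m+n a z<s

inRange-suc : ∀ {a n i} → InRange (suc a) n i → InRange a (suc n) i
inRange-suc {a} {n} {i} (a<i , i<) = <⇒≤ a<i , subst (i <_) (sym (+-suc a n)) i<

inRange-zero : ∀ {a i} → InRange a 0 i → ⊥
inRange-zero {a} (a≤i , i<a+0) = <⇒≱ i<a+0 (subst (_≤ _) (sym (+-identityʳ a)) a≤i)

inRange-cases : ∀ {a n i} → InRange a (suc n) i → i ≡ a ⊎ InRange (suc a) n i
inRange-cases {a} {n} {i} (a≤i , i<) with m≤n⇒m<n∨m≡n a≤i
... | inj₂ refl = inj₁ refl
... | inj₁ a<i  = inj₂ (a<i , subst (i <_) (+-suc a n) i<)

inRange-∸⇒≤ : ∀ {A N q} → InRange (suc A) (N ∸ A) q → q ≤ N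
inRange-∸⇒≤ {A} {N} {q} (A<q , q<) with A ≤? N
... | yes A≤N = ≤-pred (subst (q <_) (cong suc (m+[n∸m]≡n A≤N)) q<)
... | no  A≰N = contradiction (subst (q <_) (trans (cong (_+_ (suc A)) (m≤n⇒m∸n≡0 (<⇒≤ (≰⇒> A≰N)))) (+-identityʳ (suc A))) q<)
                              (λ q<1+A → <⇒≱ A<q (≤-pred q<1+A))

∑ : (ℕ → ℕ) → ℕ → ℕ → ℕ
∑ f a zero    = 0
∑ f a (suc n) = f a + ∑ f (suc a) n

∏ : (ℕ → ℕ) → ℕ → ℕ → ℕ
∏ f a zero    = 1
∏ f a (suc n) = f a * ∏ f (suc a) n

count : {P : Pred ℕ 0ℓ} → Decidable P → ℕ → ℕ → ℕ
count P? a zero    = 0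
count P? a (suc n) = if does (P? a) then suc (count P? (suc a) n) else count P? (suc a) n

module _ (f : ℕ → ℕ) where

  ∏-split : ∀ a n k → ∏ f a (n + k) ≡ ∏ f a n * ∏ f (a + n) k
  ∏-split a zero    k = sym (trans (+-identityʳ _) (cong (λ b → ∏ f b k) (+-identityʳ a)))
  ∏-split a (suc n) k = begin
    f a * ∏ f (suc a) (n + k)                 ≡⟨ cong (f a *_) (∏-split (suc a) n k) ⟩
    f a * (∏ f (suc a) n * ∏ f (suc a + n) k) ≡⟨ *-assoc (f a) _ _ ⟨
    f a * ∏ f (suc a) n * ∏ f (suc a + n) k   ≡⟨ cong (λ b → f a * ∏ f (suc a) n * ∏ f b k) (+-suc a n) ⟨
    f a * ∏ f (suc a) n * ∏ f (a + suc n) k   ∎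
    where open ≡-Reasoning

  ∏-^ : ∀ k a n → ∏ (λ i → f i ^ k) a n ≡ ∏ f a n ^ k
  ∏-^ k a zero    = sym (^-zeroˡ k)
  ∏-^ k a (suc n) = trans (cong (f a ^ k *_) (∏-^ k (suc a) n)) (sym (^-distribʳ-* (f a) _ k))

  ∣∏ : ∀ {a n i} → InRange a n i → f i ∣ ∏ f a n
  ∣∏ {a} {zero}  r = contradiction r inRange-zero
  ∣∏ {a} {suc n} r with inRange-cases r
  ... | inj₁ refl = m∣m*n _
  ... | inj₂ r′   = ∣n⇒∣m*n (f a) (∣∏ r′)

  prime∣∏ : ∀ {q} a n → Prime q → q ∣ ∏ f a n → ∃[ i ] InRange a n i × q ∣ f i
  prime∣∏ a zero    q-prime q∣1 = contradiction (subst Prime (∣1⇒≡1 q∣1) q-prime) ¬prime[1]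
  prime∣∏ a (suc n) q-prime q∣ with euclidsLemma (f a) (∏ f (suc a) n) q-prime q∣
  ... | inj₁ q∣fa = a , inRange-here a n , q∣fa
  ... | inj₂ q∣∏  with prime∣∏ (suc a) n q-prime q∣∏
  ...   | i , r , q∣fi = i , inRange-suc r , q∣fi

∏-const : ∀ c a n → ∏ (λ _ → c) a n ≡ c ^ n
∏-const c a zero    = refl
∏-const c a (suc n) = cong (c *_) (∏-const c (suc a) n)

∏-mono-≤ : ∀ {f g} a n → (∀ {i} → InRange a n i → f i ≤ g i) → ∏ f a n ≤ ∏ g a n
∏-mono-≤ a zero    f≤g = ≤-refl
∏-mono-≤ a (suc n) f≤g = *-mono-≤ (f≤g (inRange-here a n)) (∏-mono-≤ (suc a) n (λ r → f≤g (inRange-suc r)))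

∏-cong : ∀ {f g} a n → (∀ {i} → InRange a n i → f i ≡ g i) → ∏ f a n ≡ ∏ g a n
∏-cong a zero    f≡g = refl
∏-cong a (suc n) f≡g = cong₂ _*_ (f≡g (inRange-here a n)) (∏-cong (suc a) n (λ r → f≡g (inRange-suc r)))

∏-pos : ∀ {f} a n → (∀ {i} → InRange a n i → 1 ≤ f i) → 1 ≤ ∏ f a n
∏-pos {f} a n f≥1 = subst (_≤ ∏ f a n) (trans (∏-const 1 a n) (^-zeroˡ n)) (∏-mono-≤ a n f≥1)

∏-* : ∀ f g a n → ∏ (λ i → f i * g i) a n ≡ ∏ f a n * ∏ g a n
∏-* f g a zero    = refl
∏-* f g a (suc n) = trans (cong (f a * g a *_) (∏-* f g (suc a) n)) (*-interchange (f a) (g a) _ _)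

∏-comm : ∀ (g : ℕ → ℕ → ℕ) a n b m →
         ∏ (λ i → ∏ (g i) b m) a n ≡ ∏ (λ j → ∏ (λ i → g i j) a n) b m
∏-comm g a zero    b m = sym (trans (∏-const 1 b m) (^-zeroˡ m))
∏-comm g a (suc n) b m = trans (cong (∏ (g a) b m *_) (∏-comm g (suc a) n b m))
                               (sym (∏-* (g a) (λ j → ∏ (λ i → g i j) (suc a) n) b m))

∑-shift : ∀ f a n → ∑ f (suc a) n ≡ ∑ (λ k → f (suc k)) a n
∑-shift f a zero    = refl
∑-shift f a (suc n) = cong (_+_ (f (suc a))) (∑-shift f (suc a) n)

∑-split : ∀ f a n k → ∑ f a (n + k) ≡ ∑ f a n + ∑ f (a + n) k
∑-split f a zero    k = cong (λ b → ∑ f b k) (sym (+-identityʳ a))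
∑-split f a (suc n) k = trans (cong (_+_ (f a)) (∑-split f (suc a) n k))
  (trans (sym (+-assoc (f a) _ _)) (cong (λ b → f a + ∑ f (suc a) n + ∑ f b k) (sym (+-suc a n))))

∑-+ : ∀ f g a n → ∑ (λ k → f k + g k) a n ≡ ∑ f a n + ∑ g a n
∑-+ f g a zero    = refl
∑-+ f g a (suc n) = trans (cong (_+_ (f a + g a)) (∑-+ f g (suc a) n)) (+-interchange (f a) (g a) _ _)

∑-*ˡ : ∀ c f a n → ∑ (λ k → c * f k) a n ≡ c * ∑ f a n
∑-*ˡ c f a zero    = sym (*-zeroʳ c)
∑-*ˡ c f a (suc n) = trans (cong (_+_ (c * f a)) (∑-*ˡ c f (suc a) n)) (sym (*-distribˡ-+ c (f a) _))

∑-cong : ∀ {f g} a n → (∀ {k} → InRange a n k → f k ≡ g k) → ∑ f a n ≡ ∑ g a n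
∑-cong a zero    f≡g = refl
∑-cong a (suc n) f≡g = cong₂ _+_ (f≡g (inRange-here a n)) (∑-cong (suc a) n (λ r → f≡g (inRange-suc r)))

∣∑ : ∀ {d} f a n → (∀ {k} → InRange a n k → d ∣ f k) → d ∣ ∑ f a n
∣∑ f a zero    d∣f = _ ∣0
∣∑ f a (suc n) d∣f = ∣m∣n⇒∣m+n (d∣f (inRange-here a n)) (∣∑ f (suc a) n (λ r → d∣f (inRange-suc r)))

module _ {P : Pred ℕ 0ℓ} (P? : Decidable P) where

  ∏-if : ∀ q a n → ∏ (λ i → if does (P? i) then q else 1) a n ≡ q ^ count P? a n
  ∏-if q a zero    = refl
  ∏-if q a (suc n) with P? a
  ... | yes _ = cong (q *_) (∏-if q (suc a) n)
  ... | no  _ = trans (+-identityʳ _) (∏-if q (suc a) n)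

  count-split : ∀ a n k → count P? a (n + k) ≡ count P? a n + count P? (a + n) k
  count-split a zero    k = cong (λ b → count P? b k) (sym (+-identityʳ a))
  count-split a (suc n) k with P? a
  ... | yes _ = cong suc (trans (count-split (suc a) n k) (cong (λ b → count P? (suc a) n + count P? b k) (sym (+-suc a n))))
  ... | no  _ = trans (count-split (suc a) n k) (cong (λ b → count P? (suc a) n + count P? b k) (sym (+-suc a n)))

  count-monoʳ-≤ : ∀ a {n k} → n ≤ k → count P? a n ≤ count P? a k
  count-monoʳ-≤ a {n} {k} n≤k = begin
    count P? a n                            ≤⟨ m≤m+n _ _ ⟩
    count P? a n + count P? (a + n) (k ∸ n) ≡⟨ count-split a n (k ∸ n) ⟨
    count P? a (n + (k ∸ n))                ≡⟨ cong (count P? a) (m+[n∸m]≡n n≤k) ⟩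
    count P? a k                            ∎
    where open ≤-Reasoning

  count-all : ∀ a n → (∀ {i} → InRange a n i → P i) → count P? a n ≡ n
  count-all a zero    all = refl
  count-all a (suc n) all with P? a
  ... | yes _  = cong suc (count-all (suc a) n (λ r → all (inRange-suc r)))
  ... | no ¬Pa = contradiction (all (inRange-here a n)) ¬Pa

  count-pos : ∀ a n {i} → InRange a n i → P i → 0 < count P? a n
  count-pos a zero    r Pi = contradiction r inRange-zero
  count-pos a (suc n) r Pi with P? a | inRange-cases r
  ... | yes _  | _         = z<s
  ... | no ¬Pa | inj₁ refl = contradiction Pi ¬Pa
  ... | no  _  | inj₂ r′   = count-pos (suc a) n r′ Pi

  count-none : ∀ a n → (∀ {i} → InRange a n i → ¬ P i) → count P? a n ≡ 0
  count-none a zero    ¬P = refl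
  count-none a (suc n) ¬P with P? a
  ... | yes Pa = contradiction Pa (¬P (inRange-here a n))
  ... | no  _  = count-none (suc a) n (λ r → ¬P (inRange-suc r))

  count-witness : ∀ a n → 0 < count P? a n → ∃[ i ] InRange a n i × P i
  count-witness a (suc n) pos with P? a
  ... | yes Pa = a , inRange-here a n , Pa
  ... | no  _  with count-witness (suc a) n pos
  ...   | i , r , Pi = i , inRange-suc r , Pi

module _ {P Q : Pred ℕ 0ℓ} (P? : Decidable P) (Q? : Decidable Q) where

  count-mono : ∀ a n → (∀ {i} → InRange a n i → P i → Q i) → count P? a n ≤ count Q? a n
  count-mono a zero    P⇒Q = z≤n
  count-mono a (suc n) P⇒Q with P? a | Q? a
  ... | yes Pa | no ¬Qa = contradiction (P⇒Q (inRange-here a n) Pa) ¬Qa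
  ... | yes _  | yes _  = s≤s (count-mono (suc a) n (λ r → P⇒Q (inRange-suc r)))
  ... | no  _  | yes _  = m≤n⇒m≤1+n (count-mono (suc a) n (λ r → P⇒Q (inRange-suc r)))
  ... | no  _  | no  _  = count-mono (suc a) n (λ r → P⇒Q (inRange-suc r))

  count-single≤ : ∀ a {b m} → (P a → 0 < count Q? b m) → count P? a 1 ≤ count Q? b m
  count-single≤ a P⇒pos with P? a
  ... | yes Pa = P⇒pos Pa
  ... | no  _  = z≤n

  count-mono-except : ∀ r a n → (∀ {i} → InRange a n i → P i → i ≢ r → Q i) →
                      count P? a n ≤ suc (count Q? a n)
  count-mono-except r a zero    P⇒Q = z≤n
  count-mono-except r a (suc n) P⇒Q with P? a | Q? a
  ... | no  _  | yes _  = m≤n⇒m≤1+n (count-mono-except r (suc a) n (λ x → P⇒Q (inRange-suc x)))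
  ... | no  _  | no  _  = count-mono-except r (suc a) n (λ x → P⇒Q (inRange-suc x))
  ... | yes _  | yes _  = s≤s (count-mono-except r (suc a) n (λ x → P⇒Q (inRange-suc x)))
  ... | yes Pa | no ¬Qa with a ≟ r
  ...   | no a≢r  = contradiction (P⇒Q (inRange-here a n) Pa a≢r) ¬Qa
  ...   | yes refl = s≤s (count-mono (suc a) n (λ x Pi → P⇒Q (inRange-suc x) Pi (>⇒≢ (proj₁ x))))

prime>1 : ∀ {q} → Prime q → 1 < q
prime>1 q-prime = nonTrivial⇒n>1 _ {{prime⇒nonTrivial q-prime}}

prime>0 : ∀ {q} → Prime q → 0 < q
prime>0 q-prime = <-trans z<s (prime>1 q-prime)

prime∤1 : ∀ {q} → Prime q → q ∤ 1
prime∤1 q-prime q∣1 = ¬prime[1] (subst Prime (∣1⇒≡1 q∣1) q-prime)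

prime∤* : ∀ {q m n} → Prime q → q ∤ m → q ∤ n → q ∤ m * n
prime∤* {m = m} {n} q-prime q∤m q∤n q∣mn with euclidsLemma m n q-prime q∣mn
... | inj₁ q∣m = q∤m q∣m
... | inj₂ q∣n = q∤n q∣n

prime∤prime : ∀ {q r} → Prime q → Prime r → q ≢ r → q ∤ r
prime∤prime q-prime r-prime q≢r q∣r with prime⇒irreducible r-prime q∣r
... | inj₁ refl = ¬prime[1] q-prime
... | inj₂ q≡r  = q≢r q≡r

prime-induction : ∀ {ℓ} (P : ℕ → Set ℓ) → P 1 → (∀ {q m} → Prime q → P m → P (q * m)) →
                  ∀ n .{{_ : NonZero n}} → P n
prime-induction P P1 P* n = subst P (sym isFactorisation) (products factorsPrime)
  where
  open PrimeFactorisation (factorise n)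
  products : ∀ {qs} → All Prime qs → P (product qs)
  products []               = P1
  products (q-prime ∷ qs-prime) = P* q-prime (products qs-prime)

prime∤⇒coprime : ∀ {q n} → Prime q → q ∤ n → Coprime q n
prime∤⇒coprime q-prime q∤n (d∣q , d∣n) with prime⇒irreducible q-prime d∣q
... | inj₁ d≡1  = d≡1
... | inj₂ refl = contradiction d∣n q∤n

coprime-*ˡ : ∀ {a b c} → Coprime a c → Coprime b c → Coprime (a * b) c
coprime-*ˡ {a} a⊥c b⊥c (d∣ab , d∣c) =
  b⊥c (coprime-divisor (λ (e∣d , e∣a) → a⊥c (e∣a , ∣-trans e∣d d∣c)) d∣ab , d∣c)

coprime-^ˡ : ∀ {a c} j → Coprime a c → Coprime (a ^ j) c
coprime-^ˡ zero    a⊥c (d∣1 , _) = ∣1⇒≡1 d∣1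
coprime-^ˡ (suc j) a⊥c = coprime-*ˡ a⊥c (coprime-^ˡ j a⊥c)

prime-power∣*⇒∣ : ∀ {q m n} j → Prime q → q ∤ n → q ^ j ∣ m * n → q ^ j ∣ m
prime-power∣*⇒∣ {q} {m} {n} j q-prime q∤n qʲ∣mn =
  coprime-divisor (coprime-^ˡ j (prime∤⇒coprime q-prime q∤n)) (subst (q ^ j ∣_) (*-comm m n) qʲ∣mn)

coprime⇒*∣ : ∀ {a b n} → Coprime a b → a ∣ n → b ∣ n → a * b ∣ n
coprime⇒*∣ {a} {b} a⊥b (divides k n≡ka) b∣n = subst (a * b ∣_) (trans (*-comm a k) (sym n≡ka)) (*-monoʳ-∣ a b∣k)
  where
  b∣k : b ∣ k
  b∣k = coprime-divisor (Coprime.sym a⊥b) (subst (b ∣_) (trans n≡ka (*-comm k a)) b∣n)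

∣-via-prime-powers : ∀ a .{{_ : NonZero a}} b → (∀ {q} j → Prime q → q ^ j ∣ a → q ^ j ∣ b) → a ∣ b
∣-via-prime-powers = prime-induction (λ a → ∀ b → (∀ {q} j → Prime q → q ^ j ∣ a → q ^ j ∣ b) → a ∣ b)
  (λ b _ → 1∣ b) step
  where
  step : ∀ {q m} → Prime q → (∀ b → (∀ {r} j → Prime r → r ^ j ∣ m → r ^ j ∣ b) → m ∣ b) →
         ∀ b → (∀ {r} j → Prime r → r ^ j ∣ q * m → r ^ j ∣ b) → q * m ∣ b
  step {q} {m} q-prime ih b powers = subst (q * m ∣_) (sym b≡qc) (*-monoʳ-∣ q (ih c powers′))
    where
    q∣b : q ∣ b
    q∣b = subst (_∣ b) (*-identityʳ q) (powers 1 q-prime (*-monoʳ-∣ q (1∣ m)))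
    c = quotient q∣b
    b≡qc : b ≡ q * c
    b≡qc = m∣n⇒n≡m*quotient q∣b
    powers′ : ∀ {r} j → Prime r → r ^ j ∣ m → r ^ j ∣ c
    powers′ {r} j r-prime rʲ∣m with r ≟ q
    ... | yes refl = *-cancelˡ-∣ r {{prime⇒nonZero r-prime}}
                       (subst (r ^ suc j ∣_) b≡qc (powers (suc j) r-prime (*-monoʳ-∣ r rʲ∣m)))
    ... | no  r≢q  = prime-power∣*⇒∣ j r-prime (prime∤prime r-prime q-prime r≢q)
                       (subst (r ^ j ∣_) (trans b≡qc (*-comm q c)) (powers j r-prime (∣n⇒∣m*n q rʲ∣m)))

∏-distinctPrimes∣ : ∀ {g X} a n → (∀ {i} → InRange a n i → g i ≡ 1 ⊎ (Prime i × g i ≡ i × i ∣ X)) → ∏ g a n ∣ X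
∏-distinctPrimes∣ {g} {X} a zero    _       = 1∣ X
∏-distinctPrimes∣ {g} {X} a (suc n) factors with factors (inRange-here a n)
... | inj₁ ga≡1 = subst (_∣ X) (sym (trans (cong (_* ∏ g (suc a) n) ga≡1) (*-identityˡ (∏ g (suc a) n)))) rest∣X
  where rest∣X = ∏-distinctPrimes∣ (suc a) n (λ r → factors (inRange-suc r))
... | inj₂ (a-prime , ga≡a , a∣X) = subst (λ c → c * ∏ g (suc a) n ∣ X) (sym ga≡a)
      (coprime⇒*∣ (prime∤⇒coprime a-prime a∤rest) a∣X (∏-distinctPrimes∣ (suc a) n (λ r → factors (inRange-suc r))))
  where
  a∤rest : a ∤ ∏ g (suc a) n
  a∤rest a∣rest with prime∣∏ g (suc a) n a-prime a∣rest
  ... | i , r , a∣gi with factors (inRange-suc r)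
  ...   | inj₁ gi≡1 = prime∤1 a-prime (subst (a ∣_) gi≡1 a∣gi)
  ...   | inj₂ (i-prime , gi≡i , _) with prime⇒irreducible i-prime (subst (a ∣_) gi≡i a∣gi)
  ...     | inj₁ refl = ¬prime[1] a-prime
  ...     | inj₂ refl = <-irrefl refl (proj₁ r)

n!≥1 : ∀ n → 1 ≤ n !
n!≥1 n = >-nonZero⁻¹ (n !) {{n !≢0}}

prime∣n!⇒≤ : ∀ {q} n → Prime q → q ∣ n ! → q ≤ n
prime∣n!⇒≤ zero    q-prime q∣1 = contradiction q∣1 (prime∤1 q-prime)
prime∣n!⇒≤ (suc n) q-prime q∣n! with euclidsLemma (suc n) (n !) q-prime q∣n!
... | inj₁ q∣1+n = ∣⇒≤ q∣1+n
... | inj₂ q∣n!  = m≤n⇒m≤1+n (prime∣n!⇒≤ n q-prime q∣n!)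

∣n! : ∀ {i n} → 1 ≤ i → i ≤ n → i ∣ n !
∣n! {suc i} _ i≤n = ∣-trans (m∣m*n (i !)) (m≤n⇒m!∣n! i≤n)

ifPrime : (ℕ → ℕ) → ℕ → ℕ
ifPrime g q = if does (prime? q) then g q else 1

∏ᵖ : (ℕ → ℕ) → ℕ → ℕ → ℕ
∏ᵖ g = ∏ (ifPrime g)

ifPrime-¬prime : ∀ g {q} → ¬ Prime q → ifPrime g q ≡ 1
ifPrime-¬prime g {q} ¬q-prime with prime? q
... | yes q-prime = contradiction q-prime ¬q-prime
... | no  _       = refl

ifPrime≤ : ∀ g {q y} → (Prime q → g q ≤ y) → 1 ≤ y → ifPrime g q ≤ y
ifPrime≤ g {q} g≤y 1≤y with prime? q
... | yes q-prime = g≤y q-prime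
... | no  _       = 1≤y

∏ᵖ-mono-≤ : ∀ {g h} a n → (∀ {q} → InRange a n q → Prime q → g q ≤ h q) → ∏ᵖ g a n ≤ ∏ᵖ h a n
∏ᵖ-mono-≤ {g} {h} a n g≤h = ∏-mono-≤ a n term
  where
  term : ∀ {q} → InRange a n q → ifPrime g q ≤ ifPrime h q
  term {q} r with prime? q
  ... | yes q-prime = g≤h r q-prime
  ... | no  _       = ≤-refl

∏ᵖ-^ : ∀ g k a n → ∏ᵖ (λ q → g q ^ k) a n ≡ ∏ᵖ g a n ^ k
∏ᵖ-^ g k a n = trans (∏-cong a n term) (∏-^ (ifPrime g) k a n)
  where
  term : ∀ {q} → InRange a n q → ifPrime (λ q → g q ^ k) q ≡ ifPrime g q ^ k
  term {q} _ with prime? q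
  ... | yes _ = refl
  ... | no  _ = sym (^-zeroˡ k)

∏ᵖ-cong : ∀ {g h} a n → (∀ q → g q ≡ h q) → ∏ᵖ g a n ≡ ∏ᵖ h a n
∏ᵖ-cong a n g≡h = ∏-cong a n (λ {q} _ → cong (λ x → if does (prime? q) then x else 1) (g≡h q))

∣∏ᵖ : ∀ g {a n q} → Prime q → InRange a n q → g q ∣ ∏ᵖ g a n
∣∏ᵖ g {q = q} q-prime r with ∣∏ (ifPrime g) r
... | q∣∏ with prime? q
...   | yes _ = q∣∏
...   | no ¬q-prime = contradiction q-prime ¬q-prime

∏ᵖ-pos : ∀ {g} a n → (∀ {q} → Prime q → 1 ≤ g q) → 1 ≤ ∏ᵖ g a n
∏ᵖ-pos {g} a n g≥1 = ∏-pos a n term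
  where
  term : ∀ {q} → InRange a n q → 1 ≤ ifPrime g q
  term {q} _ with prime? q
  ... | yes q-prime = g≥1 q-prime
  ... | no  _       = ≤-refl

-- Legendre's formula

factorial-step : ∀ {q} → Prime q → ∀ n {r} → r < q → ∃[ R ] q ∤ R × (n * q + r) ! ≡ (n * q) ! * R
factorial-step {q} q-prime n {zero} _ = 1 , prime∤1 q-prime ,
  trans (cong _! (+-identityʳ (n * q))) (sym (*-identityʳ ((n * q) !)))
factorial-step {q} q-prime n {suc r} 1+r<q with factorial-step q-prime n (<-trans (n<1+n r) 1+r<q)
... | R , q∤R , eq = X * R , prime∤* q-prime q∤X q∤R , (begin
  (n * q + suc r) !   ≡⟨ cong _! (+-suc (n * q) r) ⟩
  suc (n * q + r) !   ≡⟨ cong (_* (n * q + r) !) (+-suc (n * q) r) ⟨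
  X * (n * q + r) !   ≡⟨ cong (X *_) eq ⟩
  X * ((n * q) ! * R) ≡⟨ x∙yz≈y∙xz X ((n * q) !) R ⟩
  (n * q) ! * (X * R) ∎)
  where
  open ≡-Reasoning
  X = n * q + suc r
  q∤X : q ∤ X
  q∤X q∣X = <⇒≱ 1+r<q (∣⇒≤ (∣m+n∣m⇒∣n q∣X (n∣m*n n)))

factorial-multiple : ∀ q → Prime (suc q) → ∀ b → ∃[ R ] suc q ∤ R × (b * suc q) ! ≡ suc q ^ b * b ! * R
factorial-multiple q q-prime zero    = 1 , prime∤1 q-prime , refl
factorial-multiple q q-prime (suc b) with factorial-multiple q q-prime b | factorial-step q-prime b (n<1+n q)
... | R , Q∤R , eq | R′ , Q∤R′ , eq′ = R * R′ , prime∤* q-prime Q∤R Q∤R′ , (begin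
  (suc b * Q) !                            ≡⟨ cong _! bQ+Q≡1+bQ+q ⟩
  suc (b * Q + q) * (b * Q + q) !          ≡⟨ cong (suc (b * Q + q) *_) (trans eq′ (cong (_* R′) eq)) ⟩
  suc (b * Q + q) * (Q ^ b * b ! * R * R′) ≡⟨ cong (_* (Q ^ b * b ! * R * R′)) (sym bQ+Q≡1+bQ+q) ⟩
  suc b * Q * (Q ^ b * b ! * R * R′)       ≡⟨ solve 6 (λ b Q x f R R′ → (con 1 :+ b) :* Q :* (x :* f :* R :* R′) := Q :* x :* ((con 1 :+ b) :* f) :* (R :* R′)) refl b Q (Q ^ b) (b !) R R′ ⟩
  Q ^ suc b * suc b ! * (R * R′)           ∎)
  where
  open ℕ-Solver
  open ≡-Reasoning
  Q = suc q
  bQ+Q≡1+bQ+q : suc b * Q ≡ suc (b * Q + q)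
  bQ+Q≡1+bQ+q = solve 2 (λ b q → (con 1 :+ b) :* (con 1 :+ q) := con 1 :+ (b :* (con 1 :+ q) :+ q)) refl b q

factorial-split : ∀ q → Prime (suc q) → ∀ N →
                  ∃[ R ] suc q ∤ R × N ! ≡ suc q ^ (N / suc q) * (N / suc q) ! * R
factorial-split q q-prime N with factorial-multiple q q-prime (N / suc q) | factorial-step q-prime (N / suc q) (m%n<n N (suc q))
... | R , Q∤R , eq | R′ , Q∤R′ , eq′ = R * R′ , prime∤* q-prime Q∤R Q∤R′ , (begin
  N !                                ≡⟨ cong _! (trans (m≡m%n+[m/n]*n N Q) (+-comm (N % Q) _)) ⟩
  (N / Q * Q + N % Q) !              ≡⟨ trans eq′ (cong (_* R′) eq) ⟩
  Q ^ (N / Q) * (N / Q) ! * R * R′   ≡⟨ *-assoc (Q ^ (N / Q) * (N / Q) !) R R′ ⟩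
  Q ^ (N / Q) * (N / Q) ! * (R * R′) ∎)
  where
  open ≡-Reasoning
  Q = suc q

-- v_q(N!) = ⌊N/q⌋ + v_q(⌊N/q⌋!) by factorial-split, and inductively v_q(b!) ≤ 2⌊b/q⌋ ≤ b.
legendre-bound : ∀ q → Prime (suc q) → ∀ N {j} → suc q ^ j ∣ N ! → j ≤ 2 * (N / suc q)
legendre-bound q q-prime = <-rec _ bound
  where
  Q = suc q
  2[b/Q]≤b : ∀ b → 2 * (b / Q) ≤ b
  2[b/Q]≤b b = ≤-trans (≤-reflexive (*-comm 2 (b / Q))) (≤-trans (*-monoʳ-≤ (b / Q) (prime>1 q-prime)) (m/n*n≤m b Q))
  bound : ∀ N → (∀ {M} → M < N → ∀ {j} → Q ^ j ∣ M ! → j ≤ 2 * (M / Q)) → ∀ {j} → Q ^ j ∣ N ! → j ≤ 2 * (N / Q)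
  bound zero    _ {zero}  _     = z≤n
  bound zero    _ {suc j} Qʲ∣1  = contradiction (∣-trans (m∣m*n (Q ^ j)) Qʲ∣1) (prime∤1 q-prime)
  bound N@(suc _) ih {j} Qʲ∣N! with factorial-split q q-prime N | j ≤? N / Q
  ... | _ , _ , _       | yes j≤b = ≤-trans j≤b (m≤n*m (N / Q) 2)
  ... | R , Q∤R , N!≡   | no  j≰b = begin
    j           ≡⟨ m+[n∸m]≡n b≤j ⟨
    b + (j ∸ b) ≤⟨ +-monoʳ-≤ b (≤-trans (ih (m/n<m N Q (prime>1 q-prime)) Qⁱ∣b!) (2[b/Q]≤b b)) ⟩
    b + b       ≡⟨ cong (_+_ b) (+-identityʳ b) ⟨
    2 * b       ∎
    where
    open ≤-Reasoning
    b = N / Q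
    b≤j = <⇒≤ (≰⇒> j≰b)
    Qⁱ∣b!R : Q ^ (j ∸ b) ∣ b ! * R
    Qⁱ∣b!R = *-cancelˡ-∣ (Q ^ b) {{m^n≢0 Q b}} (subst₂ _∣_
      (trans (cong (Q ^_) (sym (m+[n∸m]≡n b≤j))) (^-distribˡ-+-* Q b (j ∸ b)))
      (trans N!≡ (*-assoc (Q ^ b) (b !) R)) Qʲ∣N!)
    Qⁱ∣b! : Q ^ (j ∸ b) ∣ b !
    Qⁱ∣b! = prime-power∣*⇒∣ (j ∸ b) q-prime Q∤R Qⁱ∣b!R

n!∣∏ᵖ : ∀ N → N ! ∣ ∏ᵖ (λ q → q ^ (2 * (N ÷ q))) 0 (suc N)
n!∣∏ᵖ N = ∣-via-prime-powers (N !) {{N !≢0}} _ prime-power∣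
  where
  prime-power∣ : ∀ {r} j → Prime r → r ^ j ∣ N ! → r ^ j ∣ ∏ᵖ (λ q → q ^ (2 * (N ÷ q))) 0 (suc N)
  prime-power∣ zero    _       _     = 1∣ _
  prime-power∣ {zero}  (suc j) r-prime _ = contradiction r-prime ¬prime[0]
  prime-power∣ {suc r} (suc j) r-prime rʲ∣N! = ∣-trans (^-monoʳ-∣ (suc r) (legendre-bound r r-prime N {suc j} rʲ∣N!))
    (∣∏ᵖ (λ q → q ^ (2 * (N ÷ q))) r-prime (z≤n , s≤s (prime∣n!⇒≤ N r-prime (∣-trans (m∣m*n (suc r ^ j)) rʲ∣N!))))

n!≤∏ᵖ² : ∀ N → N ! ≤ ∏ᵖ (λ q → q ^ (N ÷ q)) 0 (suc N) ^ 2
n!≤∏ᵖ² N = begin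
  N !                                    ≤⟨ ∣⇒≤ {{>-nonZero ∏ᵖ≥1}} (n!∣∏ᵖ N) ⟩
  ∏ᵖ (λ q → q ^ (2 * (N ÷ q))) 0 (suc N) ≡⟨ ∏ᵖ-cong 0 (suc N) q²ˣ≡[qˣ]² ⟩
  ∏ᵖ (λ q → (q ^ (N ÷ q)) ^ 2) 0 (suc N) ≡⟨ ∏ᵖ-^ (λ q → q ^ (N ÷ q)) 2 0 (suc N) ⟩
  ∏ᵖ (λ q → q ^ (N ÷ q)) 0 (suc N) ^ 2   ∎
  where
  open ≤-Reasoning
  ∏ᵖ≥1 : 1 ≤ ∏ᵖ (λ q → q ^ (2 * (N ÷ q))) 0 (suc N)
  ∏ᵖ≥1 = ∏ᵖ-pos 0 (suc N) (λ {q} q-prime → m^n>0 q {{prime⇒nonZero q-prime}} (2 * (N ÷ q)))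
  q²ˣ≡[qˣ]² : ∀ q → q ^ (2 * (N ÷ q)) ≡ (q ^ (N ÷ q)) ^ 2
  q²ˣ≡[qˣ]² q = trans (cong (q ^_) (*-comm 2 (N ÷ q))) (sym (^-*-assoc q (N ÷ q) 2))

n^k≤[k+n]! : ∀ k n → n ^ k ≤ (k + n) !
n^k≤[k+n]! zero    n = n!≥1 n
n^k≤[k+n]! (suc k) n = *-mono-≤ (≤-trans (m≤n+m n k) (n≤1+n _)) (n^k≤[k+n]! k n)

-- Binomial coefficients and Chebyshev's bound

binomial : ∀ a n → (1 + a) ^ n ≡ ∑ (λ k → (n C k) * a ^ k) 0 (suc n)
binomial a zero    = refl
binomial a (suc n) = begin
  (1 + a) * (1 + a) ^ n                                             ≡⟨ cong ((1 + a) *_) (binomial a n) ⟩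
  (1 + a) * S                                                       ≡⟨ solve 2 (λ a S → (con 1 :+ a) :* S := S :+ a :* S) refl a S ⟩
  S + a * S                                                         ≡⟨ cong (λ x → x + a * S) S≡1+aU ⟩
  1 + a * U + a * S                                                 ≡⟨ solve 3 (λ a S U → con 1 :+ a :* U :+ a :* S := con 1 :+ (a :* S :+ a :* U)) refl a S U ⟩
  1 + (a * S + a * U)                                               ≡⟨ cong (λ x → 1 + (a * S + a * x)) U≡∑ ⟩
  1 + (a * S + a * ∑ u 0 (suc n))                                   ≡⟨ cong (λ x → 1 + (a * S + x)) (∑-*ˡ a u 0 (suc n)) ⟨
  1 + (a * S + ∑ (λ k → a * u k) 0 (suc n))                         ≡⟨ cong (λ x → 1 + (x + ∑ (λ k → a * u k) 0 (suc n))) (∑-*ˡ a (t n) 0 (suc n)) ⟨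
  1 + (∑ (λ k → a * t n k) 0 (suc n) + ∑ (λ k → a * u k) 0 (suc n)) ≡⟨ cong suc (∑-+ (λ k → a * t n k) (λ k → a * u k) 0 (suc n)) ⟨
  1 + ∑ (λ k → a * t n k + a * u k) 0 (suc n)                       ≡⟨ cong suc (∑-cong {λ k → a * t n k + a * u k} {λ k → t (suc n) (suc k)} 0 (suc n) (λ {k} _ → pascal k)) ⟩
  1 + ∑ (λ k → t (suc n) (suc k)) 0 (suc n)                         ≡⟨ cong suc (∑-shift (t (suc n)) 0 (suc n)) ⟨
  ∑ (t (suc n)) 0 (suc (suc n))                                     ∎
  where
  open ℕ-Solver
  open ≡-Reasoning
  t : ℕ → ℕ → ℕ
  t n k = (n C k) * a ^ k
  u : ℕ → ℕ
  u k = (n C suc k) * a ^ k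
  S = ∑ (t n) 0 (suc n)
  U = ∑ u 0 n
  S≡1+aU : S ≡ 1 + a * U
  S≡1+aU = cong suc (trans (∑-shift (t n) 0 n)
    (trans (∑-cong {λ k → t n (suc k)} {λ k → a * u k} 0 n (λ {k} _ → x∙yz≈y∙xz (n C suc k) a (a ^ k))) (∑-*ˡ a u 0 n)))
  U≡∑ : U ≡ ∑ u 0 (suc n)
  U≡∑ = sym (begin
    ∑ u 0 (suc n) ≡⟨ cong (∑ u 0) (+-comm 1 n) ⟩
    ∑ u 0 (n + 1) ≡⟨ ∑-split u 0 n 1 ⟩
    U + (u n + 0) ≡⟨ cong (λ c → U + (c * a ^ n + 0)) (k>n⇒nCk≡0 (n<1+n n)) ⟩
    U + 0         ≡⟨ +-identityʳ U ⟩
    U             ∎)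
  pascal : ∀ k → a * t n k + a * u k ≡ t (suc n) (suc k)
  pascal k = trans (solve 4 (λ a c d x → a :* (c :* x) :+ a :* (d :* x) := (c :+ d) :* (a :* x)) refl a (n C k) (n C suc k) (a ^ k))
                   (cong (_* (a * a ^ k)) (nCk+nC[k+1]≡[n+1]C[k+1] n k))

∑-binomials : ∀ n → ∑ (n C_) 0 (suc n) ≡ 2 ^ n
∑-binomials n = sym (trans (binomial 1 n) (∑-cong 0 (suc n) (λ {k} _ → trans (cong ((n C k) *_) (^-zeroˡ k)) (*-identityʳ (n C k)))))

nCk*k![n∸k]!≡n! : ∀ {n k} → k ≤ n → (n C k) * (k ! * (n ∸ k) !) ≡ n !
nCk*k![n∸k]!≡n! {n} {k} k≤n = trans (cong (_* (k ! * (n ∸ k) !)) (nCk≡n!/k![n-k]! k≤n))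
                                     (m/n*n≡m {{k !* (n ∸ k) !≢0}} (k![n∸k]!∣n! k≤n))

nCk>0 : ∀ {n k} → k ≤ n → 0 < n C k
nCk>0 {n} {k} k≤n = n≢0⇒n>0 (λ nCk≡0 → ≢-nonZero⁻¹ (n !) {{n !≢0}}
  (trans (sym (nCk*k![n∸k]!≡n! k≤n)) (cong (_* (k ! * (n ∸ k) !)) nCk≡0)))

prime∣nCk : ∀ {q n k} → Prime q → k < q → n ∸ k < q → q ≤ n → q ∣ n C k
prime∣nCk {q} {n} {k} q-prime k<q n∸k<q q≤n with euclidsLemma (n C k) (k ! * (n ∸ k) !) q-prime
  (subst (q ∣_) (sym (nCk*k![n∸k]!≡n! (<⇒≤ (<-≤-trans k<q q≤n)))) (∣n! (prime>0 q-prime) q≤n))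
... | inj₁ q∣nCk = q∣nCk
... | inj₂ q∣k![n∸k]! = contradiction q∣k![n∸k]! (prime∤* q-prime
      (λ q∣k! → <⇒≱ k<q (prime∣n!⇒≤ k q-prime q∣k!))
      (λ q∣[n∸k]! → <⇒≱ n∸k<q (prime∣n!⇒≤ (n ∸ k) q-prime q∣[n∸k]!)))

[1+m+m]∸m≡1+m : ∀ m → suc (m + m) ∸ m ≡ suc m
[1+m+m]∸m≡1+m m = trans (cong (_∸ m) (sym (+-suc m m))) (m+n∸m≡n m (suc m))

central-binomial≤ : ∀ m → suc (m + m) C m ≤ 4 ^ m
central-binomial≤ m = *-cancelˡ-≤ 2 (begin
  2 * (n C m)                              ≡⟨ cong (λ x → n C m + x) (trans (+-identityʳ (n C m)) C-sym) ⟩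
  n C m + n C suc m                        ≤⟨ m≤m+n (n C m + n C suc m) _ ⟩
  n C m + n C suc m + ∑ (n C_) (2 + m) m   ≡⟨ +-assoc (n C m) _ _ ⟩
  n C m + (n C suc m + ∑ (n C_) (2 + m) m) ≤⟨ m≤n+m _ (∑ (n C_) 0 m) ⟩
  ∑ (n C_) 0 m + ∑ (n C_) m (2 + m)        ≡⟨ ∑-split (n C_) 0 m (2 + m) ⟨
  ∑ (n C_) 0 (m + (2 + m))                 ≡⟨ cong (∑ (n C_) 0) (trans (+-suc m (suc m)) (cong suc (+-suc m m))) ⟩
  ∑ (n C_) 0 (suc n)                       ≡⟨ ∑-binomials n ⟩
  2 ^ n                                    ≡⟨ cong (λ x → 2 * 2 ^ x) (cong (_+_ m) (+-identityʳ m)) ⟨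
  2 * 2 ^ (2 * m)                          ≡⟨ cong (2 *_) (^-*-assoc 2 2 m) ⟨
  2 * 4 ^ m                                ∎)
  where
  open ≤-Reasoning
  n = suc (m + m)
  C-sym : n C m ≡ n C suc m
  C-sym = trans (nCk≡nC[n∸k] (≤-trans (m≤m+n m m) (n≤1+n _))) (cong (n C_) ([1+m+m]∸m≡1+m m))

primorial : ℕ → ℕ
primorial n = ∏ᵖ id 0 (suc n)

even-or-odd : ∀ n → ∃[ m ] (n ≡ m + m ⊎ n ≡ suc (m + m))
even-or-odd zero    = 0 , inj₁ refl
even-or-odd (suc n) with even-or-odd n
... | m , inj₁ refl = m , inj₂ refl
... | m , inj₂ refl = suc m , inj₁ (cong suc (sym (+-suc m m)))

¬prime[m+m] : ∀ m → 2 ≤ m → ¬ Prime (m + m)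
¬prime[m+m] m 2≤m m+m-prime with prime⇒irreducible m+m-prime (divides m (trans (cong (_+_ m) (sym (+-identityʳ m))) (*-comm 2 m)))
... | inj₁ ()
... | inj₂ 2≡m+m = <-irrefl 2≡m+m (+-mono-≤ (≤-trans (s≤s (s≤s z≤n)) 2≤m) (≤-trans (s≤s z≤n) 2≤m))

∏ᵖ-id∣central-binomial : ∀ m → ∏ᵖ id (2 + m) m ∣ suc (m + m) C m
∏ᵖ-id∣central-binomial m = ∏-distinctPrimes∣ (2 + m) m factor
  where
  factor : ∀ {q} → InRange (2 + m) m q → ifPrime id q ≡ 1 ⊎ (Prime q × ifPrime id q ≡ q × q ∣ suc (m + m) C m)
  factor {q} (2+m≤q , q<2+m+m) with prime? q
  ... | no  _       = inj₁ refl
  ... | yes q-prime = inj₂ (q-prime , refl , prime∣nCk q-prime (<-trans (n<1+n m) 2+m≤q)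
    (subst (_< q) (sym ([1+m+m]∸m≡1+m m)) 2+m≤q) (≤-pred q<2+m+m))

primorial≤4^n : ∀ n → primorial n ≤ 4 ^ n
primorial≤4^n = <-rec _ bound
  where
  bound : ∀ n → (∀ {k} → k < n → primorial k ≤ 4 ^ k) → primorial n ≤ 4 ^ n
  bound n ih with even-or-odd n
  ... | 0 , inj₁ refl = ≤-refl
  ... | 1 , inj₁ refl = s≤s (s≤s z≤n)
  ... | 0 , inj₂ refl = s≤s z≤n
  ... | m@(suc (suc k)) , inj₁ refl = begin
    primorial (m + m)                                ≡⟨ cong (∏ᵖ id 0) (+-comm 1 (m + m)) ⟩
    ∏ᵖ id 0 (m + m + 1)                              ≡⟨ ∏-split (ifPrime id) 0 (m + m) 1 ⟩
    primorial (suc k + m) * (ifPrime id (m + m) * 1) ≡⟨ cong (λ x → primorial (suc k + m) * (x * 1)) ifPrime[m+m]≡1 ⟩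
    primorial (suc k + m) * 1                        ≡⟨ *-identityʳ _ ⟩
    primorial (suc k + m)                            ≤⟨ ih (n<1+n _) ⟩
    4 ^ (suc k + m)                                  ≤⟨ ^-monoʳ-≤ 4 (n≤1+n (suc k + m)) ⟩
    4 ^ (m + m)                                      ∎
    where
    open ≤-Reasoning
    ifPrime[m+m]≡1 : ifPrime id (m + m) ≡ 1
    ifPrime[m+m]≡1 = ifPrime-¬prime id (¬prime[m+m] m (s≤s (s≤s z≤n)))
  ... | m@(suc k) , inj₂ refl = begin
    primorial (suc (m + m))             ≡⟨ ∏-split (ifPrime id) 0 (2 + m) m ⟩
    primorial (suc m) * ∏ᵖ id (2 + m) m ≤⟨ *-mono-≤ (ih (s≤s (s≤s (m≤n+m m k)))) (∣⇒≤ {{>-nonZero (nCk>0 (≤-trans (m≤m+n m m) (n≤1+n _)))}} (∏ᵖ-id∣central-binomial m)) ⟩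
    4 ^ suc m * (suc (m + m) C m)       ≤⟨ *-monoʳ-≤ (4 ^ suc m) (central-binomial≤ m) ⟩
    4 ^ suc m * 4 ^ m                   ≡⟨ ^-distribˡ-+-* 4 (suc m) m ⟨
    4 ^ suc (m + m)                     ∎
    where open ≤-Reasoning

-- A Mertens-type lower bound

mertensProduct : ℕ → ℕ → ℕ → ℕ
mertensProduct T A N = ∏ᵖ (λ q → q ^ (T ÷ q)) (suc A) (N ∸ A)

dyadic-block≤ : ∀ N A .{{_ : NonZero A}} → ∏ᵖ (λ q → q ^ (N ÷ q)) (suc A) A ≤ 16 ^ N
dyadic-block≤ N A = begin
  ∏ᵖ (λ q → q ^ (N ÷ q)) (suc A) A              ≤⟨ ∏ᵖ-mono-≤ (suc A) A exponent≤ ⟩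
  ∏ᵖ (λ q → q ^ (N / A)) (suc A) A              ≡⟨ ∏ᵖ-^ id (N / A) (suc A) A ⟩
  ∏ᵖ id (suc A) A ^ (N / A)                     ≤⟨ ^-monoˡ-≤ (N / A) (m≤n*m _ (∏ᵖ id 0 (suc A)) {{>-nonZero (∏ᵖ-pos 0 (suc A) prime>0)}}) ⟩
  (∏ᵖ id 0 (suc A) * ∏ᵖ id (suc A) A) ^ (N / A) ≡⟨ cong (_^ (N / A)) (∏-split (ifPrime id) 0 (suc A) A) ⟨
  primorial (A + A) ^ (N / A)                   ≤⟨ ^-monoˡ-≤ (N / A) (primorial≤4^n (A + A)) ⟩
  (4 ^ (A + A)) ^ (N / A)                       ≡⟨ ^-*-assoc 4 (A + A) (N / A) ⟩
  4 ^ ((A + A) * (N / A))                       ≤⟨ ^-monoʳ-≤ 4 [A+A][N/A]≤2N ⟩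
  4 ^ (2 * N)                                   ≡⟨ ^-*-assoc 4 2 N ⟨
  16 ^ N                                        ∎
  where
  open ℕ-Solver
  open ≤-Reasoning
  exponent≤ : ∀ {q} → InRange (suc A) A q → Prime q → q ^ (N ÷ q) ≤ q ^ (N / A)
  exponent≤ {suc q} (A<q , _) _ = ^-monoʳ-≤ (suc q) (/-monoʳ-≤ N (<⇒≤ A<q))
  [A+A][N/A]≤2N : (A + A) * (N / A) ≤ 2 * N
  [A+A][N/A]≤2N = begin
    (A + A) * (N / A) ≡⟨ solve 2 (λ a x → (a :+ a) :* x := con 2 :* (x :* a)) refl A (N / A) ⟩
    2 * (N / A * A)   ≤⟨ *-monoʳ-≤ 2 (m/n*n≤m N A) ⟩
    2 * N             ∎

small-primes≤ : ∀ N a → ∏ᵖ (λ q → q ^ (N ÷ q)) 0 (suc (2 ^ a)) ≤ 16 ^ (N * a)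
small-primes≤ N zero    = m^n>0 16 (N * 0)
small-primes≤ N (suc a) = begin
  ∏ᵖ g 0 (suc (2 ^ suc a))        ≡⟨ cong (λ x → ∏ᵖ g 0 (suc (A + x))) (+-identityʳ A) ⟩
  ∏ᵖ g 0 (suc A + A)              ≡⟨ ∏-split (ifPrime g) 0 (suc A) A ⟩
  ∏ᵖ g 0 (suc A) * ∏ᵖ g (suc A) A ≤⟨ *-mono-≤ (small-primes≤ N a) (dyadic-block≤ N A {{m^n≢0 2 a}}) ⟩
  16 ^ (N * a) * 16 ^ N           ≡⟨ ^-distribˡ-+-* 16 (N * a) N ⟨
  16 ^ (N * a + N)                ≡⟨ cong (16 ^_) (trans (+-comm (N * a) N) (sym (*-suc N a))) ⟩
  16 ^ (N * suc a)                ∎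
  where
  open ≤-Reasoning
  A = 2 ^ a
  g = λ q → q ^ (N ÷ q)

n!≤2^[8Na]*mertensProduct² : ∀ N a → 2 ^ a ≤ N → N ! ≤ 2 ^ (8 * N * a) * mertensProduct N (2 ^ a) N ^ 2
n!≤2^[8Na]*mertensProduct² N a A≤N = begin
  N !                           ≤⟨ n!≤∏ᵖ² N ⟩
  ∏ᵖ g 0 (suc N) ^ 2            ≡⟨ cong (λ n → ∏ᵖ g 0 (suc n) ^ 2) (m+[n∸m]≡n A≤N) ⟨
  ∏ᵖ g 0 (suc A + (N ∸ A)) ^ 2  ≡⟨ cong (_^ 2) (∏-split (ifPrime g) 0 (suc A) (N ∸ A)) ⟩
  (∏ᵖ g 0 (suc A) * B) ^ 2      ≤⟨ ^-monoˡ-≤ 2 (*-monoˡ-≤ B (small-primes≤ N a)) ⟩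
  (16 ^ (N * a) * B) ^ 2        ≡⟨ ^-distribʳ-* (16 ^ (N * a)) B 2 ⟩
  (16 ^ (N * a)) ^ 2 * B ^ 2    ≡⟨ cong (_* B ^ 2) (trans (^-*-assoc 16 (N * a) 2) (^-*-assoc 2 4 (N * a * 2))) ⟩
  2 ^ (4 * (N * a * 2)) * B ^ 2 ≡⟨ cong (λ e → 2 ^ e * B ^ 2) (solve 2 (λ n a → con 4 :* (n :* a :* con 2) := con 8 :* n :* a) refl N a) ⟩
  2 ^ (8 * N * a) * B ^ 2       ∎
  where
  open ℕ-Solver
  open ≤-Reasoning
  A = 2 ^ a
  B = mertensProduct N A N
  g = λ q → q ^ (N ÷ q)

-- (N/2)^(N/2) ≤ N! ≤ 2^(8Na) B² forces B ≥ 2^E.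
mertens-lower-bound : ∀ s a → 32 * a ≤ s + 4 →
                      2 ^ ((s + 4) * 2 ^ s) ≤ mertensProduct (2 ^ (s + 4)) (2 ^ a) (2 ^ (s + 4))
mertens-lower-bound s a 32a≤s+4 = ≮⇒≥ (λ B<2ᴱ → <⇒≱ (^-monoˡ-< 2 B<2ᴱ) [2ᴱ]²≤B²)
  where
  open ℕ-Solver
  open ≤-Reasoning
  N = 2 ^ (s + 4)
  A = 2 ^ a
  X = 2 ^ s
  E = (s + 4) * X
  B = mertensProduct N A N
  h = 2 ^ (s + 3)

  A≤N : A ≤ N
  A≤N = ^-monoʳ-≤ 2 (≤-trans (m≤n*m a 32) 32a≤s+4)

  N!-lower : 2 ^ ((s + 3) * h) ≤ N !
  N!-lower = begin
    2 ^ ((s + 3) * h)     ≡⟨ ^-*-assoc 2 (s + 3) h ⟨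
    h ^ h                 ≤⟨ n^k≤[k+n]! h h ⟩
    (h + h) !             ≡⟨ cong _! (trans (cong (_+_ h) (sym (+-identityʳ h))) (sym (^-distribˡ-+-* 2 1 (s + 3)))) ⟩
    (2 ^ (1 + (s + 3))) ! ≡⟨ cong (λ e → (2 ^ e) !) (+-comm 1 (s + 3)) ⟩
    (2 ^ (s + 3 + 1)) !   ≡⟨ cong (λ e → (2 ^ e) !) (+-assoc s 3 1) ⟩
    N !                   ∎

  exponents : 8 * N * a + 2 * E ≤ (s + 3) * h
  exponents = begin
    8 * N * a + 2 * E                    ≡⟨ cong (λ n → 8 * n * a + 2 * E) (^-distribˡ-+-* 2 s 4) ⟩
    8 * (X * 16) * a + 2 * ((s + 4) * X) ≡⟨ solve 3 (λ x a s → con 8 :* (x :* con 16) :* a :+ con 2 :* ((s :+ con 4) :* x) := (con 4 :* (con 32 :* a) :+ con 2 :* s :+ con 8) :* x) refl X a s ⟩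
    (4 * (32 * a) + 2 * s + 8) * X       ≤⟨ *-monoˡ-≤ X (+-monoˡ-≤ 8 (+-monoˡ-≤ (2 * s) (*-monoʳ-≤ 4 32a≤s+4))) ⟩
    (4 * (s + 4) + 2 * s + 8) * X        ≤⟨ *-monoˡ-≤ X (≤-trans (≤-reflexive (solve 1 (λ s → con 4 :* (s :+ con 4) :+ con 2 :* s :+ con 8 := con 6 :* s :+ con 24) refl s)) (+-monoˡ-≤ 24 (*-monoˡ-≤ s {6} {8} (m≤m+n 6 2)))) ⟩
    (8 * s + 24) * X                     ≡⟨ solve 2 (λ s x → (con 8 :* s :+ con 24) :* x := (s :+ con 3) :* (x :* con 8)) refl s X ⟩
    (s + 3) * (X * 8)                    ≡⟨ cong ((s + 3) *_) (^-distribˡ-+-* 2 s 3) ⟨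
    (s + 3) * h                          ∎

  [2ᴱ]²≤B² : (2 ^ E) ^ 2 ≤ B ^ 2
  [2ᴱ]²≤B² = *-cancelˡ-≤ (2 ^ (8 * N * a)) {{m^n≢0 2 (8 * N * a)}} (begin
    2 ^ (8 * N * a) * (2 ^ E) ^ 2 ≡⟨ cong (2 ^ (8 * N * a) *_) (trans (^-*-assoc 2 E 2) (cong (2 ^_) (*-comm E 2))) ⟩
    2 ^ (8 * N * a) * 2 ^ (2 * E) ≡⟨ ^-distribˡ-+-* 2 (8 * N * a) (2 * E) ⟨
    2 ^ (8 * N * a + 2 * E)       ≤⟨ ^-monoʳ-≤ 2 exponents ⟩
    2 ^ ((s + 3) * h)             ≤⟨ N!-lower ⟩
    N !                           ≤⟨ n!≤2^[8Na]*mertensProduct² N a A≤N ⟩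
    2 ^ (8 * N * a) * B ^ 2       ∎)

mertensProduct-scale : ∀ N T A M t → t * N ≤ T → mertensProduct N A M ^ t ≤ mertensProduct T A M
mertensProduct-scale N T A M t tN≤T = begin
  mertensProduct N A M ^ t                     ≡⟨ ∏ᵖ-^ (λ q → q ^ (N ÷ q)) t (suc A) (M ∸ A) ⟨
  ∏ᵖ (λ q → (q ^ (N ÷ q)) ^ t) (suc A) (M ∸ A) ≤⟨ ∏ᵖ-mono-≤ (suc A) (M ∸ A) exponent≤ ⟩
  mertensProduct T A M                         ∎
  where
  open ℕ-Solver
  open ≤-Reasoning
  exponent≤ : ∀ {q} → InRange (suc A) (M ∸ A) q → Prime q → (q ^ (N ÷ q)) ^ t ≤ q ^ (T ÷ q)
  exponent≤ {suc q} _ _ = ≤-trans (≤-reflexive (^-*-assoc (suc q) (N / suc q) t))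
    (^-monoʳ-≤ (suc q) (≤-trans (≤-reflexive (sym (m*n/n≡m (N / suc q * t) (suc q)))) (/-monoˡ-≤ (suc q) (begin
      N / suc q * t * suc q   ≡⟨ solve 3 (λ x y z → x :* y :* z := y :* (x :* z)) refl (N / suc q) t (suc q) ⟩
      t * (N / suc q * suc q) ≤⟨ *-monoʳ-≤ t (m/n*n≤m N (suc q)) ⟩
      t * N                   ≤⟨ tN≤T ⟩
      T                       ∎))))

-- Smooth numbers

-- Positivity is part of the definition, which makes smoothness decidable by a bounded search.
Smooth : ℕ → ℕ → Set
Smooth N n = 1 ≤ n × (∀ {q} → Prime q → q ∣ n → q ≤ N)

smooth? : ∀ N n → Dec (Smooth N n)
smooth? N zero    = no (λ ())
smooth? N (suc n) = map′
  (λ small → s≤s z≤n , λ {q} q-prime q∣n → small {q} (s≤s (∣⇒≤ q∣n)) (q-prime , q∣n))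
  (λ (_ , small) {q} _ (q-prime , q∣n) → small q-prime q∣n)
  (allUpTo? (λ q → (prime? q ×-dec q ∣? suc n) →-dec q ≤? N) (suc (suc n)))

smooth-* : ∀ {N m n} → Smooth N m → Smooth N n → Smooth N (m * n)
smooth-* {m = m} {n} (m≥1 , m-small) (n≥1 , n-small) = *-mono-≤ m≥1 n≥1 , small
  where
  small : ∀ {q} → Prime q → q ∣ m * n → q ≤ _
  small q-prime q∣mn with euclidsLemma m n q-prime q∣mn
  ... | inj₁ q∣m = m-small q-prime q∣m
  ... | inj₂ q∣n = n-small q-prime q∣n

≤N⇒smooth : ∀ {N n} → 1 ≤ n → n ≤ N → Smooth N n
≤N⇒smooth {n = n} n≥1 n≤N = n≥1 , λ _ q∣n → ≤-trans (∣⇒≤ {{>-nonZero n≥1}} q∣n) n≤N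

Ψ : ℕ → ℕ → ℕ
Ψ N x = count (smooth? N) 1 x

x≤N⇒Ψ≡x : ∀ N {x} → x ≤ N → Ψ N x ≡ x
x≤N⇒Ψ≡x N x≤N = count-all (smooth? N) 1 _ (λ (1≤n , n<1+x) → ≤N⇒smooth 1≤n (≤-trans (≤-pred n<1+x) x≤N))

Ψ-mono-≤ : ∀ N {x y} → x ≤ y → Ψ N x ≤ Ψ N y
Ψ-mono-≤ N = count-monoʳ-≤ (smooth? N) 1

SmoothMultiple : ℕ → ℕ → ℕ → Set
SmoothMultiple N q n = Prime q × Smooth N n × q ∣ n

smoothMultiple? : ∀ N q n → Dec (SmoothMultiple N q n)
smoothMultiple? N q n = prime? q ×-dec smooth? N n ×-dec q ∣? n

Ψ≤count-smoothMultiple : ∀ {N q} → Prime q → q ≤ N → ∀ z → Ψ N z ≤ count (smoothMultiple? N q) 1 (z * q)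
Ψ≤count-smoothMultiple q-prime q≤N zero    = z≤n
Ψ≤count-smoothMultiple {N} {q} q-prime q≤N (suc z) = begin
  Ψ N (suc z)                                   ≡⟨ cong (Ψ N) (+-comm 1 z) ⟩
  Ψ N (z + 1)                                   ≡⟨ count-split (smooth? N) 1 z 1 ⟩
  Ψ N z + count (smooth? N) (suc z) 1           ≤⟨ +-mono-≤ (Ψ≤count-smoothMultiple q-prime q≤N z) last ⟩
  count M? 1 (z * q) + count M? (suc (z * q)) q ≡⟨ count-split M? 1 (z * q) q ⟨
  count M? 1 (z * q + q)                        ≡⟨ cong (count M? 1) (+-comm (z * q) q) ⟩
  count M? 1 (suc z * q)                        ∎
  where
  open ≤-Reasoning
  M? = smoothMultiple? N q
  last : count (smooth? N) (suc z) 1 ≤ count M? (suc (z * q)) q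
  last = count-single≤ (smooth? N) M? (suc z) {suc (z * q)} {q} λ 1+z-smooth → count-pos M? (suc (z * q)) q {suc z * q}
    (+-monoˡ-≤ (z * q) (prime>0 q-prime) , s≤s (≤-reflexive (+-comm q (z * q))))
    (q-prime , smooth-* 1+z-smooth (≤N⇒smooth (prime>0 q-prime) q≤N) , n∣m*n (suc z))

-- The map n ↦ n q embeds the smooth n ≤ x/q into the smooth multiples of q up to x, and the primes
-- q ∣ n multiply to at most n ≤ x.
buchstab : ∀ N A x → ∏ᵖ (λ q → q ^ Ψ N (x ÷ q)) (suc A) (N ∸ A) ≤ x ^ Ψ N x
buchstab N A x = begin
  ∏ᵖ (λ q → q ^ Ψ N (x ÷ q)) (suc A) len            ≤⟨ ∏-mono-≤ (suc A) len Ψ[x/q]≤multiples ⟩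
  ∏ (λ q → q ^ count (M? q) 1 x) (suc A) len        ≡⟨ ∏-cong (suc A) len (λ {q} _ → ∏-if (M? q) q 1 x) ⟨
  ∏ (λ q → ∏ (h q) 1 x) (suc A) len                 ≡⟨ ∏-comm h (suc A) len 1 x ⟩
  ∏ (λ n → ∏ (λ q → h q n) (suc A) len) 1 x         ≤⟨ ∏-mono-≤ 1 x primes-of-n≤ ⟩
  ∏ (λ n → if does (smooth? N n) then x else 1) 1 x ≡⟨ ∏-if (smooth? N) x 1 x ⟩
  x ^ Ψ N x                                         ∎
  where
  open ≤-Reasoning
  len = N ∸ A
  M? = smoothMultiple? N
  h : ℕ → ℕ → ℕ
  h q n = if does (M? q n) then q else 1

  Ψ[x/q]≤multiples : ∀ {q} → InRange (suc A) len q → ifPrime (λ q → q ^ Ψ N (x ÷ q)) q ≤ q ^ count (M? q) 1 x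
  Ψ[x/q]≤multiples {q} (A<q , q<) = ifPrime≤ (λ q → q ^ Ψ N (x ÷ q))
    (λ q-prime → ^-monoʳ-≤ q {{prime⇒nonZero q-prime}} (Ψ≤multiples q q-prime (inRange-∸⇒≤ (A<q , q<))))
    (m^n>0 q {{>-nonZero (≤-trans z<s A<q)}} (count (M? q) 1 x))
    where
    Ψ≤multiples : ∀ q → Prime q → q ≤ N → Ψ N (x ÷ q) ≤ count (M? q) 1 x
    Ψ≤multiples (suc q) q-prime q≤N = ≤-trans (Ψ≤count-smoothMultiple q-prime q≤N (x / suc q))
                                              (count-monoʳ-≤ (M? (suc q)) 1 (m/n*n≤m x (suc q)))

  primes-of-n≤ : ∀ {n} → InRange 1 x n → ∏ (λ q → h q n) (suc A) len ≤ (if does (smooth? N n) then x else 1)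
  primes-of-n≤ {n} (n≥1 , n<1+x) = cases (smooth? N n)
    where
    ∏h = ∏ (λ q → h q n) (suc A) len
    cases : (d : Dec (Smooth N n)) → ∏h ≤ (if does d then x else 1)
    cases (yes _)      = ≤-trans (∣⇒≤ {{>-nonZero n≥1}} (∏-distinctPrimes∣ (suc A) len factor)) (≤-pred n<1+x)
      where
      factor : ∀ {q} → InRange (suc A) len q → h q n ≡ 1 ⊎ (Prime q × h q n ≡ q × q ∣ n)
      factor {q} _ = factor-cases (M? q n)
        where
        factor-cases : (d : Dec (SmoothMultiple N q n)) →
                       (if does d then q else 1) ≡ 1 ⊎ (Prime q × (if does d then q else 1) ≡ q × q ∣ n)
        factor-cases (yes (q-prime , _ , q∣n)) = inj₂ (q-prime , refl , q∣n)
        factor-cases (no  _)                   = inj₁ refl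
    cases (no ¬smooth) = ≤-trans (∏-mono-≤ (suc A) len (λ {q} _ → ≤-reflexive (h≡1 {q}))) (≤-reflexive (trans (∏-const 1 (suc A) len) (^-zeroˡ len)))
      where
      h≡1 : ∀ {q} → h q n ≡ 1
      h≡1 {q} = cong (if_then q else 1) (dec-false (M? q n) (λ (_ , smooth , _) → ¬smooth smooth))

-- A lower bound for Ψ

Ψ-recurrence : ∀ s a → 32 * a ≤ s + 4 → ∀ ℓ x e t .{{_ : NonZero ℓ}} → x ≤ 2 ^ e → t * 2 ^ (s + 4) ≤ x / ℓ →
               (∀ y → y * 2 ^ a ≤ x → y ≤ ℓ * Ψ (2 ^ (s + 4)) y) →
               (s + 4) * 2 ^ s * t ≤ e * Ψ (2 ^ (s + 4)) x
Ψ-recurrence s a 32a≤s+4 ℓ x e t x≤2ᵉ tN≤T ih = 2^-cancel-≤ (begin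
  2 ^ ((s + 4) * 2 ^ s * t)                ≡⟨ ^-*-assoc 2 ((s + 4) * 2 ^ s) t ⟨
  (2 ^ ((s + 4) * 2 ^ s)) ^ t              ≤⟨ ^-monoˡ-≤ t (mertens-lower-bound s a 32a≤s+4) ⟩
  mertensProduct N A N ^ t                 ≤⟨ mertensProduct-scale N T A N t tN≤T ⟩
  mertensProduct T A N                     ≤⟨ ∏ᵖ-mono-≤ (suc A) (N ∸ A) T/q≤Ψ[x/q] ⟩
  ∏ᵖ (λ q → q ^ ψ (x ÷ q)) (suc A) (N ∸ A) ≤⟨ buchstab N A x ⟩
  x ^ ψ x                                  ≤⟨ ^-monoˡ-≤ (ψ x) x≤2ᵉ ⟩
  (2 ^ e) ^ ψ x                            ≡⟨ ^-*-assoc 2 e (ψ x) ⟩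
  2 ^ (e * ψ x)                            ∎)
  where
  open ≤-Reasoning
  N = 2 ^ (s + 4)
  A = 2 ^ a
  T = x / ℓ
  ψ = Ψ N
  T/q≤Ψ[x/q] : ∀ {q} → InRange (suc A) (N ∸ A) q → Prime q → q ^ (T ÷ q) ≤ q ^ ψ (x ÷ q)
  T/q≤Ψ[x/q] {suc q} (A<q , _) _ = ^-monoʳ-≤ (suc q) (begin
    x / ℓ / suc q ≡⟨ m/n/o≡m/o/n x ℓ (suc q) ⟩
    x / suc q / ℓ ≤⟨ m≤n*o⇒m/n≤o ℓ (ih (x / suc q) (≤-trans (*-monoʳ-≤ (x / suc q) (<⇒≤ A<q)) (m/n*n≤m x (suc q)))) ⟩
    ψ (x / suc q) ∎)

Ψ-lower-bound-step : ∀ s a → 32 * a ≤ s + 4 → ∀ k ℓ x .{{_ : NonZero ℓ}} →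
                     2 ^ (s + 4) < x → x ≤ 2 ^ (s + 4 + suc k * a) →
                     (∀ y → y * 2 ^ a ≤ x → y ≤ ℓ * Ψ (2 ^ (s + 4)) y) →
                     suc (x / ℓ) ≤ 33 * (2 + k) * Ψ (2 ^ (s + 4)) x
Ψ-lower-bound-step s a 32a≤s+4 k ℓ x N<x x≤2ᵉ ih with 2 ^ (s + 4) ≤? x / ℓ
... | no  N≰T = ≤-trans (≰⇒> N≰T) (≤-trans N≤ψ (m≤n*m ψ (33 * (2 + k))))
  where
  N = 2 ^ (s + 4)
  ψ = Ψ N x
  N≤ψ : N ≤ ψ
  N≤ψ = ≤-trans (≤-reflexive (sym (x≤N⇒Ψ≡x N ≤-refl))) (Ψ-mono-≤ N (<⇒≤ N<x))
... | yes N≤T = begin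
  suc T                          ≡⟨ +-comm 1 T ⟩
  T + 1                          ≤⟨ +-monoʳ-≤ T (≤-trans (m^n>0 2 (s + 4)) N≤ψ) ⟩
  T + ψ                          ≤⟨ +-mono-≤ T≤32[2+k]ψ (m≤n*m ψ (2 + k)) ⟩
  32 * (2 + k) * ψ + (2 + k) * ψ ≡⟨ solve 2 (λ k p → con 32 :* (con 2 :+ k) :* p :+ (con 2 :+ k) :* p := con 33 :* (con 2 :+ k) :* p) refl k ψ ⟩
  33 * (2 + k) * ψ               ∎
  where
  open ℕ-Solver
  open ≤-Reasoning
  N = 2 ^ (s + 4)
  instance _ = m^n≢0 2 (s + 4)
  T = x / ℓ
  t = T / N
  ψ = Ψ N x
  e = s + 4 + suc k * a
  N≤ψ : N ≤ ψ
  N≤ψ = ≤-trans (≤-reflexive (sym (x≤N⇒Ψ≡x N ≤-refl))) (Ψ-mono-≤ N (<⇒≤ N<x))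
  T≤32·2ˢt : T ≤ 32 * (2 ^ s * t)
  T≤32·2ˢt = begin
    T                    ≤⟨ <⇒≤ (m<n*suc[m/n] T N) ⟩
    N * suc t            ≤⟨ *-monoʳ-≤ N (+-monoˡ-≤ t (m≥n⇒m/n>0 N≤T)) ⟩
    N * (t + t)          ≡⟨ cong (_* (t + t)) (^-distribˡ-+-* 2 s 4) ⟩
    2 ^ s * 16 * (t + t) ≡⟨ solve 2 (λ x t → x :* con 16 :* (t :+ t) := con 32 :* (x :* t)) refl (2 ^ s) t ⟩
    32 * (2 ^ s * t)     ∎
  e≤[2+k][s+4] : e ≤ (2 + k) * (s + 4)
  e≤[2+k][s+4] = +-monoʳ-≤ (s + 4) (*-monoʳ-≤ (suc k) (≤-trans (m≤n*m a 32) 32a≤s+4))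
  T≤32[2+k]ψ : T ≤ 32 * (2 + k) * ψ
  T≤32[2+k]ψ = *-cancelˡ-≤ (s + 4) {{>-nonZero (≤-trans z<s (m≤n+m 4 s))}} (begin
    (s + 4) * T                  ≤⟨ *-monoʳ-≤ (s + 4) T≤32·2ˢt ⟩
    (s + 4) * (32 * (2 ^ s * t)) ≡⟨ solve 3 (λ l x t → l :* (con 32 :* (x :* t)) := con 32 :* (l :* x :* t)) refl (s + 4) (2 ^ s) t ⟩
    32 * ((s + 4) * 2 ^ s * t)   ≤⟨ *-monoʳ-≤ 32 (Ψ-recurrence s a 32a≤s+4 ℓ x e t x≤2ᵉ (m/n*n≤m T N) ih) ⟩
    32 * (e * ψ)                 ≤⟨ *-monoʳ-≤ 32 (*-monoˡ-≤ ψ e≤[2+k][s+4]) ⟩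
    32 * ((2 + k) * (s + 4) * ψ) ≡⟨ solve 3 (λ k l p → con 32 :* ((con 2 :+ k) :* l :* p) := l :* (con 32 :* (con 2 :+ k) :* p)) refl k (s + 4) ψ ⟩
    (s + 4) * (32 * (2 + k) * ψ) ∎)

L : ℕ → ℕ
L zero    = 1
L (suc k) = 33 * (2 + k) * L k

L≥1 : ∀ k → 1 ≤ L k
L≥1 zero    = ≤-refl
L≥1 (suc k) = *-mono-≤ {1} {33 * (2 + k)} (s≤s z≤n) (L≥1 k)

Ψ-lower-bound : ∀ s a → 32 * a ≤ s + 4 → ∀ k x → x ≤ 2 ^ (s + 4 + k * a) → x ≤ L k * Ψ (2 ^ (s + 4)) x
Ψ-lower-bound s a 32a≤s+4 zero x x≤2ᵉ =
  ≤-reflexive (sym (trans (+-identityʳ _) (x≤N⇒Ψ≡x (2 ^ (s + 4)) (subst (λ e → x ≤ 2 ^ e) (+-identityʳ (s + 4)) x≤2ᵉ))))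
Ψ-lower-bound s a 32a≤s+4 (suc k) x x≤2ᵉ with x ≤? 2 ^ (s + 4)
... | yes x≤N = ≤-trans (≤-reflexive (sym (x≤N⇒Ψ≡x (2 ^ (s + 4)) x≤N))) (m≤n*m _ (L (suc k)) {{>-nonZero (L≥1 (suc k))}})
... | no  x≰N = begin
  x                      ≤⟨ <⇒≤ (m<n*suc[m/n] x ℓ) ⟩
  ℓ * suc (x / ℓ)        ≤⟨ *-monoʳ-≤ ℓ (Ψ-lower-bound-step s a 32a≤s+4 k ℓ x (≰⇒> x≰N) x≤2ᵉ ih) ⟩
  ℓ * (33 * (2 + k) * ψ) ≡⟨ x∙yz≈y∙xz ℓ (33 * (2 + k)) ψ ⟩
  33 * (2 + k) * (ℓ * ψ) ≡⟨ *-assoc (33 * (2 + k)) ℓ ψ ⟨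
  L (suc k) * ψ          ∎
  where
  open ℕ-Solver
  open ≤-Reasoning
  A = 2 ^ a
  ℓ = L k
  instance _ = >-nonZero (L≥1 k)
  ψ = Ψ (2 ^ (s + 4)) x
  ih : ∀ y → y * A ≤ x → y ≤ ℓ * Ψ (2 ^ (s + 4)) y
  ih y yA≤x = Ψ-lower-bound s a 32a≤s+4 k y (*-cancelʳ-≤ y _ A {{m^n≢0 2 a}} (begin
    y * A                   ≤⟨ yA≤x ⟩
    x                       ≤⟨ x≤2ᵉ ⟩
    2 ^ (s + 4 + suc k * a) ≡⟨ cong (2 ^_) (solve 3 (λ l k a → l :+ (con 1 :+ k) :* a := l :+ k :* a :+ a) refl (s + 4) k a) ⟩
    2 ^ (s + 4 + k * a + a) ≡⟨ ^-distribˡ-+-* 2 (s + 4 + k * a) a ⟩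
    2 ^ (s + 4 + k * a) * A ∎))

-- Polynomial congruences

-- Integer polynomial functions, by recursion on the degree in Horner form f x = x * g x + c.
DegreeAtMost : ℕ → (ℤ → ℤ) → Set
DegreeAtMost zero    f = ∃[ c ] ∀ x → f x ≡ c
DegreeAtMost (suc d) f = ∃[ g ] DegreeAtMost d g × ∃[ c ] ∀ x → f x ≡ x ℤ.* g x ℤ.+ c

Monic : ℕ → (ℤ → ℤ) → Set
Monic zero    f = ∀ x → f x ≡ 1ℤ
Monic (suc d) f = ∃[ g ] Monic d g × ∃[ c ] ∀ x → f x ≡ x ℤ.* g x ℤ.+ c

monic⇒degreeAtMost : ∀ d {f} → Monic d f → DegreeAtMost d f
monic⇒degreeAtMost zero    f≡1                 = 1ℤ , f≡1
monic⇒degreeAtMost (suc d) (g , g-monic , c , f≡) = g , monic⇒degreeAtMost d g-monic , c , f≡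

degreeAtMost-scale : ∀ d {f} r → DegreeAtMost d f → DegreeAtMost d (λ x → r ℤ.* f x)
degreeAtMost-scale zero    r (c , f≡c) = r ℤ.* c , λ x → cong (r ℤ.*_) (f≡c x)
degreeAtMost-scale (suc d) r (g , g-deg , c , f≡) = (λ x → r ℤ.* g x) , degreeAtMost-scale d r g-deg , r ℤ.* c ,
  λ x → trans (cong (r ℤ.*_) (f≡ x)) (solve 4 (λ r x g c → r :* (x :* g :+ c) := x :* (r :* g) :+ r :* c) refl r x (g x) c)
  where open ℤ-Solver

monic-+ : ∀ d {f h} → Monic (suc d) f → DegreeAtMost d h → Monic (suc d) (λ x → f x ℤ.+ h x)
monic-+ zero    (g , g-monic , c , f≡) (c′ , h≡c′) = g , g-monic , c ℤ.+ c′ ,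
  λ x → trans (cong₂ ℤ._+_ (f≡ x) (h≡c′ x)) (ℤ.+-assoc (x ℤ.* g x) c c′)
monic-+ (suc d) (g , g-monic , c , f≡) (k , k-deg , c′ , h≡) = (λ x → g x ℤ.+ k x) , monic-+ d g-monic k-deg , c ℤ.+ c′ ,
  λ x → trans (cong₂ ℤ._+_ (f≡ x) (h≡ x))
    (solve 5 (λ x a b c e → x :* a :+ b :+ (x :* c :+ e) := x :* (a :+ c) :+ (b :+ e)) refl x (g x) c (k x) c′)
  where open ℤ-Solver

factor-theorem : ∀ d {f} → Monic (suc d) f → ∀ r → ∃[ g ] Monic d g × (∀ x → f x ℤ.- f r ≡ (x ℤ.- r) ℤ.* g x)
factor-theorem zero {f} (g , g≡1 , c , f≡) r = g , g≡1 , λ x → begin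
  f x ℤ.- f r                           ≡⟨ cong₂ ℤ._-_ (f≡ x) (f≡ r) ⟩
  x ℤ.* g x ℤ.+ c ℤ.- (r ℤ.* g r ℤ.+ c) ≡⟨ cong₂ (λ u v → x ℤ.* u ℤ.+ c ℤ.- (r ℤ.* v ℤ.+ c)) (g≡1 x) (g≡1 r) ⟩
  x ℤ.* 1ℤ ℤ.+ c ℤ.- (r ℤ.* 1ℤ ℤ.+ c)   ≡⟨ solve 3 (λ x r c → x :* con 1ℤ :+ c :- (r :* con 1ℤ :+ c) := (x :- r) :* con 1ℤ) refl x r c ⟩
  (x ℤ.- r) ℤ.* 1ℤ                      ≡⟨ cong ((x ℤ.- r) ℤ.*_) (g≡1 x) ⟨
  (x ℤ.- r) ℤ.* g x                     ∎
  where
  open ≡-Reasoning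
  open ℤ-Solver
factor-theorem (suc d) {f} (g , g-monic , c , f≡) r with factor-theorem d g-monic r
... | h , h-monic , g-factors = (λ x → g x ℤ.+ r ℤ.* h x) ,
  monic-+ d g-monic (degreeAtMost-scale d r (monic⇒degreeAtMost d h-monic)) , λ x → begin
  f x ℤ.- f r                                     ≡⟨ cong₂ ℤ._-_ (f≡ x) (f≡ r) ⟩
  x ℤ.* g x ℤ.+ c ℤ.- (r ℤ.* g r ℤ.+ c)           ≡⟨ solve 5 (λ x r a b c → x :* a :+ c :- (r :* b :+ c) := (x :- r) :* a :+ r :* (a :- b)) refl x r (g x) (g r) c ⟩
  (x ℤ.- r) ℤ.* g x ℤ.+ r ℤ.* (g x ℤ.- g r)       ≡⟨ cong (λ t → (x ℤ.- r) ℤ.* g x ℤ.+ r ℤ.* t) (g-factors x) ⟩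
  (x ℤ.- r) ℤ.* g x ℤ.+ r ℤ.* ((x ℤ.- r) ℤ.* h x) ≡⟨ solve 4 (λ x r a q → (x :- r) :* a :+ r :* ((x :- r) :* q) := (x :- r) :* (a :+ r :* q)) refl x r (g x) (h x) ⟩
  (x ℤ.- r) ℤ.* (g x ℤ.+ r ℤ.* h x)               ∎
  where
  open ≡-Reasoning
  open ℤ-Solver

monic[xⁿ] : ∀ n → Monic n (ℤ._^ n)
monic[xⁿ] zero    x = refl
monic[xⁿ] (suc n) = (ℤ._^ n) , monic[xⁿ] n , 0ℤ , λ x → sym (ℤ.+-identityʳ _)

euclidsLemmaℤ : ∀ {p} → Prime p → ∀ a b → + p ℤ.∣ a ℤ.* b → + p ℤ.∣ a ⊎ + p ℤ.∣ b
euclidsLemmaℤ {p} p-prime a b p∣ab with euclidsLemma ℤ.∣ a ∣ ℤ.∣ b ∣ p-prime (subst (p ∣_) (ℤ.abs-* a b) (ℤ.∣⇒∣ᵤ p∣ab))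
... | inj₁ p∣a = inj₁ (ℤ.∣ᵤ⇒∣ p∣a)
... | inj₂ p∣b = inj₂ (ℤ.∣ᵤ⇒∣ p∣b)

p∤i-r : ∀ {p i r} → i < p → r < p → i ≢ r → ¬ (+ p ℤ.∣ + i ℤ.- + r)
p∤i-r {p} {i} {r} i<p r<p i≢r p∣i-r = cases (<-cmp i r)
  where
  p∣∣i⊖r∣ : p ∣ ℤ.∣ i ℤ.⊖ r ∣
  p∣∣i⊖r∣ = subst (λ t → p ∣ ℤ.∣ t ∣) (ℤ.m-n≡m⊖n i r) (ℤ.∣⇒∣ᵤ p∣i-r)
  cases : Tri (i < r) (i ≡ r) (r < i) → ⊥
  cases (tri≈ _ i≡r _) = i≢r i≡r
  cases (tri< i<r _ _) = <⇒≱ (≤-<-trans (m∸n≤m r i) r<p)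
    (∣⇒≤ {{>-nonZero (m<n⇒0<n∸m i<r)}} (subst (p ∣_) (ℤ.∣⊖∣-< i<r) p∣∣i⊖r∣))
  cases (tri> _ _ r<i) = <⇒≱ (≤-<-trans (m∸n≤m i r) i<p)
    (∣⇒≤ {{>-nonZero (m<n⇒0<n∸m r<i)}} (subst (p ∣_) (trans (ℤ.∣m⊖n∣≡∣n⊖m∣ i r) (ℤ.∣⊖∣-< r<i)) p∣∣i⊖r∣))

root? : ∀ p (f : ℤ → ℤ) n → Dec (+ p ℤ.∣ f (+ n))
root? p f n = + p ℤ.∣? f (+ n)

roots≤degree : ∀ {p} → Prime p → ∀ d {f} → Monic d f → count (root? p f) 0 p ≤ d
roots≤degree {p} p-prime zero {f} f≡1 = ≤-reflexive (count-none (root? p f) 0 p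
  (λ {i} _ p∣fi → prime∤1 p-prime (subst (p ∣_) (cong ℤ.∣_∣ (f≡1 (+ i))) (ℤ.∣⇒∣ᵤ p∣fi))))
roots≤degree {p} p-prime (suc d) {f} f-monic with 0 <? count (root? p f) 0 p
... | no  no-roots = ≤-trans (≮⇒≥ no-roots) z≤n
... | yes has-root with count-witness (root? p f) 0 p has-root
...   | r , (_ , r<p) , p∣fr with factor-theorem d f-monic (+ r)
...     | g , g-monic , f-factors = ≤-trans (count-mono-except (root? p f) (root? p g) r 0 p other-root⇒g-root)
                                               (s≤s (roots≤degree p-prime d g-monic))
  where
  other-root⇒g-root : ∀ {i} → InRange 0 p i → + p ℤ.∣ f (+ i) → i ≢ r → + p ℤ.∣ g (+ i)
  other-root⇒g-root {i} (_ , i<p) p∣fi i≢r with euclidsLemmaℤ p-prime (+ i ℤ.- + r) (g (+ i))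
                                                  (subst (+ p ℤ.∣_) (f-factors (+ i)) (ℤ.∣m∣n⇒∣m-n p∣fi p∣fr))
  ... | inj₁ p∣i-r = contradiction p∣i-r (p∤i-r i<p r<p i≢r)
  ... | inj₂ p∣gi  = p∣gi

-- Fermat's little theorem and power residues

freshmans-dream : ∀ {p} → Prime p → ∀ x → ∃[ m ] p ∣ m × (1 + x) ^ p ≡ 1 + m + x ^ p
freshmans-dream {suc p} p-prime x = ∑ t 1 p , ∣∑ t 1 p p∣t , (begin
  (1 + x) ^ suc p                     ≡⟨ binomial x (suc p) ⟩
  1 + ∑ t 1 (suc p)                   ≡⟨ cong (λ n → 1 + ∑ t 1 n) (+-comm 1 p) ⟩
  1 + ∑ t 1 (p + 1)                   ≡⟨ cong suc (∑-split t 1 p 1) ⟩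
  1 + (∑ t 1 p + (t (suc p) + 0))     ≡⟨ cong (λ c → 1 + (∑ t 1 p + (c * x ^ suc p + 0))) (nCn≡1 (suc p)) ⟩
  1 + (∑ t 1 p + (1 * x ^ suc p + 0)) ≡⟨ cong (λ y → 1 + (∑ t 1 p + y)) (trans (+-identityʳ _) (*-identityˡ _)) ⟩
  1 + (∑ t 1 p + x ^ suc p)           ≡⟨ +-assoc 1 (∑ t 1 p) _ ⟨
  1 + ∑ t 1 p + x ^ suc p             ∎)
  where
  open ≡-Reasoning
  t : ℕ → ℕ
  t k = (suc p C k) * x ^ k
  p∣t : ∀ {k} → InRange 1 p k → suc p ∣ t k
  p∣t {suc k} (_ , k<p) = ∣m⇒∣m*n (x ^ suc k) (prime∣nCk p-prime k<p (s≤s (m∸n≤m p k)) ≤-refl)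

+-^ : ∀ m n → + (m ^ n) ≡ (+ m) ℤ.^ n
+-^ m zero    = refl
+-^ m (suc n) = trans (ℤ.pos-* m (m ^ n)) (cong (+ m ℤ.*_) (+-^ m n))

fermat-xᵖ≡x : ∀ {p} → Prime p → ∀ x → + p ℤ.∣ (+ x) ℤ.^ p ℤ.- + x
fermat-xᵖ≡x {suc p} p-prime zero    = ℤ.divides 0ℤ refl
fermat-xᵖ≡x {p}     p-prime (suc x) with freshmans-dream p-prime x
... | m , p∣m , [1+x]ᵖ≡ = subst (+ p ℤ.∣_) (sym eq) (ℤ.∣m∣n⇒∣m+n (fermat-xᵖ≡x p-prime x) (ℤ.∣ᵤ⇒∣ p∣m))
  where
  open ℤ-Solver
  open ≡-Reasoning
  eq : (+ suc x) ℤ.^ p ℤ.- + suc x ≡ ((+ x) ℤ.^ p ℤ.- + x) ℤ.+ + m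
  eq = begin
    (+ suc x) ℤ.^ p ℤ.- + suc x                   ≡⟨ cong (ℤ._- + suc x) (+-^ (suc x) p) ⟨
    + (suc x ^ p) ℤ.- + suc x                     ≡⟨ cong (λ n → + n ℤ.- + suc x) [1+x]ᵖ≡ ⟩
    + (1 + m + x ^ p) ℤ.- + (1 + x)               ≡⟨ cong₂ ℤ._-_ (trans (ℤ.pos-+ (1 + m) _) (cong₂ ℤ._+_ (ℤ.pos-+ 1 m) (+-^ x p))) (ℤ.pos-+ 1 x) ⟩
    (1ℤ ℤ.+ + m ℤ.+ (+ x) ℤ.^ p) ℤ.- (1ℤ ℤ.+ + x) ≡⟨ solve 3 (λ m y x → con 1ℤ :+ m :+ y :- (con 1ℤ :+ x) := y :- x :+ m) refl (+ m) ((+ x) ℤ.^ p) (+ x) ⟩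
    ((+ x) ℤ.^ p ℤ.- + x) ℤ.+ + m                 ∎

fermat-yᵖ⁻¹≡1 : ∀ {p} → Prime p → ∀ {y} → ¬ p ∣ y → + p ℤ.∣ (+ y) ℤ.^ (p ∸ 1) ℤ.- 1ℤ
fermat-yᵖ⁻¹≡1 {suc p} p-prime {y} p∤y with euclidsLemmaℤ p-prime (+ y) ((+ y) ℤ.^ p ℤ.- 1ℤ) p∣y[yᵖ-1]
  where
  open ℤ-Solver
  p∣y[yᵖ-1] : + suc p ℤ.∣ + y ℤ.* ((+ y) ℤ.^ p ℤ.- 1ℤ)
  p∣y[yᵖ-1] = subst (+ suc p ℤ.∣_) (solve 2 (λ y z → y :* z :- y := y :* (z :- con 1ℤ)) refl (+ y) ((+ y) ℤ.^ p)) (fermat-xᵖ≡x p-prime y)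
... | inj₁ p∣y   = contradiction (ℤ.∣⇒∣ᵤ p∣y) p∤y
... | inj₂ p∣yᵖ-1 = p∣yᵖ-1

x-y∣xⁿ-yⁿ : ∀ x y n → x ℤ.- y ℤ.∣ x ℤ.^ n ℤ.- y ℤ.^ n
x-y∣xⁿ-yⁿ x y zero    = ℤ.divides 0ℤ (sym (ℤ.*-zeroˡ (x ℤ.- y)))
x-y∣xⁿ-yⁿ x y (suc n) = subst (x ℤ.- y ℤ.∣_) eq
  (ℤ.∣m∣n⇒∣m+n (ℤ.∣n⇒∣m*n x (x-y∣xⁿ-yⁿ x y n)) (ℤ.∣m⇒∣m*n (y ℤ.^ n) (ℤ.∣-refl {x ℤ.- y})))
  where
  open ℤ-Solver
  eq : x ℤ.* (x ℤ.^ n ℤ.- y ℤ.^ n) ℤ.+ (x ℤ.- y) ℤ.* y ℤ.^ n ≡ x ℤ.^ suc n ℤ.- y ℤ.^ suc n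
  eq = solve 4 (λ x y a b → x :* (a :- b) :+ (x :- y) :* b := x :* a :- y :* b) refl x y (x ℤ.^ n) (y ℤ.^ n)

powerResidue⇒p∣qᵈ-1 : ∀ {p M d q} → Prime p → M * d ≡ p ∸ 1 → IsPowerResidue M p q → + p ℤ.∣ (+ q) ℤ.^ d ℤ.- 1ℤ
powerResidue⇒p∣qᵈ-1 {p} {zero} {d} p-prime 0≡p-1 _ = contradiction (m∸n≡0⇒m≤n (sym 0≡p-1)) (<⇒≱ (prime>1 p-prime))
powerResidue⇒p∣qᵈ-1 {p} {M@(suc M′)} {d} {q} p-prime Md≡p-1 (q⊥p , y , p∣q-yᴹ) =
  subst (+ p ℤ.∣_) (solve 2 (λ a b → (a :- b) :+ (b :- con 1ℤ) := a :- con 1ℤ) refl ((+ q) ℤ.^ d) yᵖ⁻¹)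
    (ℤ.∣m∣n⇒∣m+n p∣qᵈ-yᵖ⁻¹ (fermat-yᵖ⁻¹≡1 p-prime p∤y))
  where
  open ℤ-Solver
  yᵖ⁻¹ = (+ y) ℤ.^ (p ∸ 1)
  p∣qᵈ-yᵖ⁻¹ : + p ℤ.∣ (+ q) ℤ.^ d ℤ.- yᵖ⁻¹
  p∣qᵈ-yᵖ⁻¹ = subst (λ z → + p ℤ.∣ (+ q) ℤ.^ d ℤ.- z)
    (trans (sym (+-^ (y ^ M) d)) (trans (cong +_ (trans (^-*-assoc y M d) (cong (y ^_) Md≡p-1))) (+-^ y (p ∸ 1))))
    (ℤ.∣-trans (ℤ.∣ᵤ⇒∣ p∣q-yᴹ) (x-y∣xⁿ-yⁿ (+ q) (+ (y ^ M)) d))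
  p∤y : ¬ p ∣ y
  p∤y p∣y = <⇒≢ (prime>1 p-prime) (sym (q⊥p (p∣q , ∣-refl)))
    where
    p∣q : p ∣ q
    p∣q = ℤ.∣⇒∣ᵤ (subst (+ p ℤ.∣_) (solve 2 (λ a b → a :- b :+ b := a) refl (+ q) (+ (y ^ M)))
                   (ℤ.∣m∣n⇒∣m+n {+ p} {+ q ℤ.- + (y ^ M)} {+ (y ^ M)} (ℤ.∣ᵤ⇒∣ p∣q-yᴹ) (ℤ.∣ᵤ⇒∣ (∣m⇒∣m*n (y ^ M′) p∣y))))

smooth⇒p∣nᵈ-1 : ∀ {p N d} → (∀ {q} → Prime q → q ≤ N → + p ℤ.∣ (+ q) ℤ.^ d ℤ.- 1ℤ) →
             ∀ {n} → Smooth N n → + p ℤ.∣ (+ n) ℤ.^ d ℤ.- 1ℤ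
smooth⇒p∣nᵈ-1 {p} {N} {d} primes⇒p∣qᵈ-1 {n} (n≥1 , n-small) = prime-induction P base step n {{>-nonZero n≥1}} n-small
  where
  open ℤ-Solver
  P : ℕ → Set
  P n = (∀ {q} → Prime q → q ∣ n → q ≤ N) → + p ℤ.∣ (+ n) ℤ.^ d ℤ.- 1ℤ
  base : P 1
  base _ = ℤ.divides 0ℤ (trans (cong (ℤ._- 1ℤ) (ℤ.^-zeroˡ d)) (sym (ℤ.*-zeroˡ (+ p))))
  step : ∀ {q m} → Prime q → P m → P (q * m)
  step {q} {m} q-prime ih qm-small = subst (+ p ℤ.∣_) eq
    (ℤ.∣m∣n⇒∣m+n (ℤ.∣n⇒∣m*n ((+ q) ℤ.^ d) (ih (λ r-prime r∣m → qm-small r-prime (∣n⇒∣m*n q r∣m))))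
                 (primes⇒p∣qᵈ-1 q-prime (qm-small q-prime (m∣m*n m))))
    where
    eq : (+ q) ℤ.^ d ℤ.* ((+ m) ℤ.^ d ℤ.- 1ℤ) ℤ.+ ((+ q) ℤ.^ d ℤ.- 1ℤ) ≡ (+ (q * m)) ℤ.^ d ℤ.- 1ℤ
    eq = trans (solve 2 (λ a b → a :* (b :- con 1ℤ) :+ (a :- con 1ℤ) := a :* b :- con 1ℤ) refl ((+ q) ℤ.^ d) ((+ m) ℤ.^ d))
               (cong (ℤ._- 1ℤ) (sym (begin
                 (+ (q * m)) ℤ.^ d           ≡⟨ +-^ (q * m) d ⟨
                 + ((q * m) ^ d)             ≡⟨ cong +_ (^-distribʳ-* q m d) ⟩
                 + (q ^ d * m ^ d)           ≡⟨ ℤ.pos-* (q ^ d) (m ^ d) ⟩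
                 + (q ^ d) ℤ.* + (m ^ d)     ≡⟨ cong₂ ℤ._*_ (+-^ q d) (+-^ m d) ⟩
                 (+ q) ℤ.^ d ℤ.* (+ m) ℤ.^ d ∎)))
      where open ≡-Reasoning

Ψ[p-1]≤d : ∀ {p N} d .{{_ : NonZero d}} → Prime p → (∀ {q} → Prime q → q ≤ N → + p ℤ.∣ (+ q) ℤ.^ d ℤ.- 1ℤ) →
             Ψ N (p ∸ 1) ≤ d
Ψ[p-1]≤d {suc p} {N} (suc d) p-prime primes⇒p∣qᵈ-1 = ≤-trans
  (count-mono (smooth? N) (root? (suc p) xᵈ⁻¹) 0 (suc p) (λ _ n-smooth → smooth⇒p∣nᵈ-1 {d = suc d} primes⇒p∣qᵈ-1 n-smooth))
  (roots≤degree p-prime (suc d) ((ℤ._^ d) , monic[xⁿ] d , ℤ.- 1ℤ , λ x → refl))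
  where
  xᵈ⁻¹ : ℤ → ℤ
  xᵈ⁻¹ x = x ℤ.^ suc d ℤ.- 1ℤ

powerResidues⇒M≤L : ∀ {p M s a k} → Prime p → M ∣ p ∸ 1 → 32 * a ≤ s + 4 → p ∸ 1 ≤ 2 ^ (s + 4 + k * a) →
                    (∀ {q} → Prime q → q ≤ 2 ^ (s + 4) → IsPowerResidue M p q) → M ≤ L k
powerResidues⇒M≤L {p} {M} {s} {a} {k} p-prime (divides d p-1≡dM) 32a≤s+4 p-1≤2ᵉ residues =
  *-cancelʳ-≤ M (L k) d {{d≢0}} (begin
    M * d             ≡⟨ Md≡p-1 ⟩
    p ∸ 1             ≤⟨ Ψ-lower-bound s a 32a≤s+4 k (p ∸ 1) p-1≤2ᵉ ⟩
    L k * Ψ N (p ∸ 1) ≤⟨ *-monoʳ-≤ (L k) (Ψ[p-1]≤d d {{d≢0}} p-prime primes⇒p∣qᵈ-1) ⟩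
    L k * d           ∎)
  where
  open ≤-Reasoning
  N = 2 ^ (s + 4)
  Md≡p-1 : M * d ≡ p ∸ 1
  Md≡p-1 = trans (*-comm M d) (sym p-1≡dM)
  d≢0 : NonZero d
  d≢0 = ≢-nonZero (λ d≡0 → <⇒≱ (prime>1 p-prime) (m∸n≡0⇒m≤n (trans p-1≡dM (cong (_* M) d≡0))))
  primes⇒p∣qᵈ-1 : ∀ {q} → Prime q → q ≤ N → + p ℤ.∣ (+ q) ℤ.^ d ℤ.- 1ℤ
  primes⇒p∣qᵈ-1 q-prime q≤N = powerResidue⇒p∣qᵈ-1 {M = M} {d} p-prime Md≡p-1 (residues q-prime q≤N)

n≤2^⌈log₂n⌉ : ∀ n → n ≤ 2 ^ ⌈log₂ n ⌉
n≤2^⌈log₂n⌉ = <-rec _ bound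
  where
  bound : ∀ n → (∀ {m} → m < n → m ≤ 2 ^ ⌈log₂ m ⌉) → n ≤ 2 ^ ⌈log₂ n ⌉
  bound zero          _  = z≤n
  bound (suc zero)    _  = ≤-refl
  bound n@(suc (suc _)) ih = begin
    n                         ≡⟨ ⌊n/2⌋+⌈n/2⌉≡n n ⟨
    ⌊ n /2⌋ + ⌈ n /2⌉         ≤⟨ +-monoˡ-≤ ⌈ n /2⌉ (⌊n/2⌋≤⌈n/2⌉ n) ⟩
    ⌈ n /2⌉ + ⌈ n /2⌉         ≤⟨ +-mono-≤ half≤ half≤ ⟩
    2 ^ (c ∸ 1) + 2 ^ (c ∸ 1) ≡⟨ cong (_+_ (2 ^ (c ∸ 1))) (+-identityʳ _) ⟨
    2 ^ suc (c ∸ 1)           ≡⟨ cong (2 ^_) (m+[n∸m]≡n c≥1) ⟩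
    2 ^ c                     ∎
    where
    open ≤-Reasoning
    c = ⌈log₂ n ⌉
    c≥1 : 1 ≤ c
    c≥1 = ⌈log₂⌉-mono-≤ {2} {n} (s≤s (s≤s z≤n))
    half≤ : ⌈ n /2⌉ ≤ 2 ^ (c ∸ 1)
    half≤ = subst (λ e → ⌈ n /2⌉ ≤ 2 ^ e) (⌈log₂⌈n/2⌉⌉≡⌈log₂n⌉∸1 n) (ih (⌈n/2⌉<n _))

2^⌊log₂n⌋≤n : ∀ n → 1 ≤ n → 2 ^ ⌊log₂ n ⌋ ≤ n
2^⌊log₂n⌋≤n = <-rec _ bound
  where
  bound : ∀ n → (∀ {m} → m < n → 1 ≤ m → 2 ^ ⌊log₂ m ⌋ ≤ m) → 1 ≤ n → 2 ^ ⌊log₂ n ⌋ ≤ n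
  bound (suc zero)      _  _ = ≤-refl
  bound n@(suc (suc _)) ih _ = begin
    2 ^ f                     ≡⟨ cong (2 ^_) (m+[n∸m]≡n f≥1) ⟨
    2 ^ suc (f ∸ 1)           ≡⟨ cong (_+_ (2 ^ (f ∸ 1))) (+-identityʳ _) ⟩
    2 ^ (f ∸ 1) + 2 ^ (f ∸ 1) ≤⟨ +-mono-≤ half≥ half≥ ⟩
    ⌊ n /2⌋ + ⌊ n /2⌋         ≤⟨ +-monoʳ-≤ ⌊ n /2⌋ (⌊n/2⌋≤⌈n/2⌉ n) ⟩
    ⌊ n /2⌋ + ⌈ n /2⌉         ≡⟨ ⌊n/2⌋+⌈n/2⌉≡n n ⟩
    n                         ∎
    where
    open ≤-Reasoning
    f = ⌊log₂ n ⌋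
    f≥1 : 1 ≤ f
    f≥1 = ⌊log₂⌋-mono-≤ {2} {n} (s≤s (s≤s z≤n))
    half≥ : 2 ^ (f ∸ 1) ≤ ⌊ n /2⌋
    half≥ = subst (λ e → 2 ^ e ≤ ⌊ n /2⌋) (⌊log₂⌊n/2⌋⌋≡⌊log₂n⌋∸1 n) (ih (⌊n/2⌋<n _) (s≤s z≤n))

n≤2^e⇒⌊log₂n⌋≤e : ∀ {n e} → n ≤ 2 ^ e → ⌊log₂ n ⌋ ≤ e
n≤2^e⇒⌊log₂n⌋≤e {e = e} n≤2ᵉ = ≤-trans (⌊log₂⌋-mono-≤ n≤2ᵉ) (≤-reflexive (⌊log₂[2^n]⌋≡n e))

n≤2^e⇒⌈log₂n⌉≤e : ∀ {n e} → n ≤ 2 ^ e → ⌈log₂ n ⌉ ≤ e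
n≤2^e⇒⌈log₂n⌉≤e {e = e} n≤2ᵉ = ≤-trans (⌈log₂⌉-mono-≤ n≤2ᵉ) (≤-reflexive (⌈log₂2^n⌉≡n e))

m<⌊log₂n⌋⇒2^m<n : ∀ {m n} → m < ⌊log₂ n ⌋ → 2 ^ m < n
m<⌊log₂n⌋⇒2^m<n {m} {zero}  ()
m<⌊log₂n⌋⇒2^m<n {m} {suc n} m<log = <-≤-trans (^-monoʳ-< 2 (s≤s (s≤s z≤n)) m<log) (2^⌊log₂n⌋≤n (suc n) (s≤s z≤n))

3≤n⇒2≤⌈log₂n⌉ : ∀ {n} → 3 ≤ n → 2 ≤ ⌈log₂ n ⌉
3≤n⇒2≤⌈log₂n⌉ {n} 3≤n = ≮⇒≥ (λ log<2 → <⇒≱ (s≤s (≤-trans (n≤2^⌈log₂n⌉ n) (^-monoʳ-≤ 2 (≤-pred log<2)))) 3≤n)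

3≤n⇒1≤⌈log₂⌈log₂n⌉⌉ : ∀ {n} → 3 ≤ n → 1 ≤ ⌈log₂ ⌈log₂ n ⌉ ⌉
3≤n⇒1≤⌈log₂⌈log₂n⌉⌉ {n} 3≤n = ⌈log₂⌉-mono-≤ {2} {⌈log₂ n ⌉} (3≤n⇒2≤⌈log₂n⌉ 3≤n)

L≤[33[1+k]]^k : ∀ k → L k ≤ (33 * suc k) ^ k
L≤[33[1+k]]^k zero    = ≤-refl
L≤[33[1+k]]^k (suc k) = *-monoʳ-≤ (33 * (2 + k)) (≤-trans (L≤[33[1+k]]^k k) (^-monoˡ-≤ k (*-monoʳ-≤ 33 (n≤1+n (suc k)))))

⌈log₂[33n]⌉≤6+⌈log₂n⌉ : ∀ n → ⌈log₂ (33 * n) ⌉ ≤ 6 + ⌈log₂ n ⌉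
⌈log₂[33n]⌉≤6+⌈log₂n⌉ n = n≤2^e⇒⌈log₂n⌉≤e (begin
  33 * n              ≤⟨ *-monoˡ-≤ n {33} {64} (m≤m+n 33 31) ⟩
  64 * n              ≤⟨ *-monoʳ-≤ 64 (n≤2^⌈log₂n⌉ n) ⟩
  64 * 2 ^ ⌈log₂ n ⌉  ≡⟨ ^-distribˡ-+-* 2 6 ⌈log₂ n ⌉ ⟨
  2 ^ (6 + ⌈log₂ n ⌉) ∎)
  where open ≤-Reasoning

⌊log₂M⌋≤8⌈log₂⌈log₂M⌉⌉k : ∀ {M k} → 3 ≤ M → M ≤ L k → ⌊log₂ M ⌋ ≤ 8 * ⌈log₂ ⌈log₂ M ⌉ ⌉ * k
⌊log₂M⌋≤8⌈log₂⌈log₂M⌉⌉k {M} {k} 3≤M M≤Lk = cases (k ≤? μ)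
  where
  open ℕ-Solver
  open ≤-Reasoning
  μ = ⌈log₂ M ⌉
  ν = ⌈log₂ μ ⌉
  μ≥2 = 3≤n⇒2≤⌈log₂n⌉ 3≤M
  ν≥1 = 3≤n⇒1≤⌈log₂⌈log₂n⌉⌉ 3≤M
  g = ⌈log₂ (33 * suc k) ⌉
  c = ⌈log₂ (suc k) ⌉
  M≤2^gk : M ≤ 2 ^ (g * k)
  M≤2^gk = begin
    M                ≤⟨ M≤Lk ⟩
    L k              ≤⟨ L≤[33[1+k]]^k k ⟩
    (33 * suc k) ^ k ≤⟨ ^-monoˡ-≤ k (n≤2^⌈log₂n⌉ (33 * suc k)) ⟩
    (2 ^ g) ^ k      ≡⟨ ^-*-assoc 2 g k ⟩
    2 ^ (g * k)      ∎
  cases : Dec (k ≤ μ) → ⌊log₂ M ⌋ ≤ 8 * ν * k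
  cases (no k≰μ) = begin
    ⌊log₂ M ⌋ ≤⟨ n≤2^e⇒⌊log₂n⌋≤e (n≤2^⌈log₂n⌉ M) ⟩
    μ         ≤⟨ <⇒≤ (≰⇒> k≰μ) ⟩
    k         ≤⟨ m≤n*m k (8 * ν) {{>-nonZero (≤-trans ν≥1 (m≤n*m ν 8))}} ⟩
    8 * ν * k ∎
  cases (yes k≤μ) = begin
    ⌊log₂ M ⌋ ≤⟨ n≤2^e⇒⌊log₂n⌋≤e M≤2^gk ⟩
    g * k     ≤⟨ *-monoˡ-≤ k (begin
      g     ≤⟨ ⌈log₂[33n]⌉≤6+⌈log₂n⌉ (suc k) ⟩
      6 + c ≤⟨ +-monoʳ-≤ 6 (begin
        ⌈log₂ (suc k) ⌉ ≤⟨ ⌈log₂⌉-mono-≤ (+-mono-≤ (≤-trans (s≤s z≤n) μ≥2) k≤μ) ⟩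
        ⌈log₂ (μ + μ) ⌉ ≡⟨ cong ⌈log₂_⌉ (cong (_+_ μ) (+-identityʳ μ)) ⟨
        ⌈log₂ (2 * μ) ⌉ ≡⟨ ⌈log₂2*n⌉≡1+⌈log₂n⌉ μ {{>-nonZero (≤-trans (s≤s z≤n) μ≥2)}} ⟩
        1 + ν           ∎) ⟩
      7 + ν     ≤⟨ +-monoˡ-≤ ν (*-monoʳ-≤ 7 ν≥1) ⟩
      7 * ν + ν ≡⟨ solve 1 (λ l → con 7 :* l :+ l := con 8 :* l) refl ν ⟩
      8 * ν     ∎) ⟩
    8 * ν * k          ∎

residues-below⇒≤p : ∀ {p M Y} → Prime p → (∀ n → 1 ≤ n → n < Y → IsPowerResidue M p n) → Y ≤ p
residues-below⇒≤p p-prime residues =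
  ≮⇒≥ (λ p<Y → <⇒≢ (prime>1 p-prime) (sym (proj₁ (residues _ (prime>0 p-prime) p<Y) (∣-refl , ∣-refl))))

M≤L[k]-for-k≲⌈log₂p⌉/⌊log₂Y⌋ : ∀ {p M Y} → Prime p → M ∣ p ∸ 1 → (∀ n → 1 ≤ n → n < Y → IsPowerResidue M p n) →
                              41 ≤ ⌊log₂ Y ⌋ → ∃[ k ] M ≤ L k × ⌊log₂ Y ⌋ * k ≤ 128 * ⌈log₂ p ⌉
M≤L[k]-for-k≲⌈log₂p⌉/⌊log₂Y⌋ {p} {M} {Y} p-prime M∣p-1 residues 41≤logY =
  k , powerResidues⇒M≤L {s = s} {a} {k} p-prime M∣p-1 32a≤s+4 p-1≤2ᵉ small-residues ,
  n*[1+L/a]≤128L logY a logp logY≤64a a≤logp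
  where
  open ℕ-Solver
  open ≤-Reasoning
  logY = ⌊log₂ Y ⌋
  logp = ⌈log₂ p ⌉
  ℓ = logY ∸ 1
  s = ℓ ∸ 4
  a = ℓ / 32
  1+ℓ≡logY : suc ℓ ≡ logY
  1+ℓ≡logY = m+[n∸m]≡n (≤-trans (s≤s z≤n) 41≤logY)
  40≤ℓ : 40 ≤ ℓ
  40≤ℓ = ≤-pred (subst (41 ≤_) (sym 1+ℓ≡logY) 41≤logY)
  s+4≡ℓ : s + 4 ≡ ℓ
  s+4≡ℓ = m∸n+n≡m (≤-trans (m≤m+n 4 36) 40≤ℓ)
  a≥1 : 1 ≤ a
  a≥1 = m≥n⇒m/n>0 (≤-trans (m≤m+n 32 8) 40≤ℓ)
  instance _ = >-nonZero a≥1
  k = suc (logp / a)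
  32a≤s+4 : 32 * a ≤ s + 4
  32a≤s+4 = ≤-trans (≤-reflexive (*-comm 32 a)) (≤-trans (m/n*n≤m ℓ 32) (≤-reflexive (sym s+4≡ℓ)))
  logY≤64a : logY ≤ 64 * a
  logY≤64a = begin
    logY         ≡⟨ 1+ℓ≡logY ⟨
    suc ℓ        ≤⟨ m<n*suc[m/n] ℓ 32 ⟩
    32 * suc a   ≤⟨ *-monoʳ-≤ 32 (+-monoˡ-≤ a a≥1) ⟩
    32 * (a + a) ≡⟨ solve 1 (λ a → con 32 :* (a :+ a) := con 64 :* a) refl a ⟩
    64 * a       ∎
  a≤logp : a ≤ logp
  a≤logp = ≤-trans (m/n≤m ℓ 32) (≤-trans (n≤1+n ℓ) (≤-trans (≤-reflexive 1+ℓ≡logY)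
             (n≤2^e⇒⌊log₂n⌋≤e (≤-trans (residues-below⇒≤p {M = M} p-prime residues) (n≤2^⌈log₂n⌉ p)))))
  p-1≤2ᵉ : p ∸ 1 ≤ 2 ^ (s + 4 + k * a)
  p-1≤2ᵉ = begin
    p ∸ 1               ≤⟨ m∸n≤m p 1 ⟩
    p                   ≤⟨ n≤2^⌈log₂n⌉ p ⟩
    2 ^ logp            ≤⟨ ^-monoʳ-≤ 2 (≤-trans (<⇒≤ (m<n*suc[m/n] logp a)) (≤-trans (≤-reflexive (*-comm a k)) (m≤n+m (k * a) (s + 4)))) ⟩
    2 ^ (s + 4 + k * a) ∎
  small-residues : ∀ {q} → Prime q → q ≤ 2 ^ (s + 4) → IsPowerResidue M p q
  small-residues {q} q-prime q≤N = residues q (prime>0 q-prime)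
    (≤-<-trans q≤N (subst (λ e → 2 ^ e < Y) (sym s+4≡ℓ) (m<⌊log₂n⌋⇒2^m<n (≤-reflexive 1+ℓ≡logY))))

bound-for-⌊log₂Y⌋≤40 : ∀ {p M Y} → ⌊log₂ Y ⌋ ≤ 40 → 3 ≤ M → M ≤ p →
                       ⌊log₂ Y ⌋ * ⌊log₂ M ⌋ ≤ 1024 * ⌈log₂ ⌈log₂ M ⌉ ⌉ * ⌈log₂ p ⌉
bound-for-⌊log₂Y⌋≤40 {p} {M} {Y} logY≤40 3≤M M≤p = begin
  ⌊log₂ Y ⌋ * ⌊log₂ M ⌋ ≤⟨ *-mono-≤ logY≤40 (n≤2^e⇒⌊log₂n⌋≤e {e = ⌈log₂ p ⌉} (≤-trans M≤p (n≤2^⌈log₂n⌉ p))) ⟩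
  40 * ⌈log₂ p ⌉        ≤⟨ *-monoˡ-≤ ⌈log₂ p ⌉ {40} {1024 * ν} (≤-trans (m≤m+n 40 984) (m≤m*n 1024 ν {{>-nonZero (3≤n⇒1≤⌈log₂⌈log₂n⌉⌉ 3≤M)}})) ⟩
  1024 * ν * ⌈log₂ p ⌉  ∎
  where
  open ≤-Reasoning
  ν = ⌈log₂ ⌈log₂ M ⌉ ⌉

bound-from-M≤L[k] : ∀ {p M Y k} → 3 ≤ M → M ≤ L k → ⌊log₂ Y ⌋ * k ≤ 128 * ⌈log₂ p ⌉ →
                    ⌊log₂ Y ⌋ * ⌊log₂ M ⌋ ≤ 1024 * ⌈log₂ ⌈log₂ M ⌉ ⌉ * ⌈log₂ p ⌉
bound-from-M≤L[k] {p} {M} {Y} {k} 3≤M M≤Lk logY*k≤ = begin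
  ⌊log₂ Y ⌋ * ⌊log₂ M ⌋     ≤⟨ *-monoʳ-≤ ⌊log₂ Y ⌋ (⌊log₂M⌋≤8⌈log₂⌈log₂M⌉⌉k 3≤M M≤Lk) ⟩
  ⌊log₂ Y ⌋ * (8 * ν * k)   ≡⟨ solve 3 (λ y v k → y :* (con 8 :* v :* k) := con 8 :* v :* (y :* k)) refl ⌊log₂ Y ⌋ ν k ⟩
  8 * ν * (⌊log₂ Y ⌋ * k)   ≤⟨ *-monoʳ-≤ (8 * ν) logY*k≤ ⟩
  8 * ν * (128 * ⌈log₂ p ⌉) ≡⟨ solve 2 (λ v p → con 8 :* v :* (con 128 :* p) := con 1024 :* v :* p) refl ν ⌈log₂ p ⌉ ⟩
  1024 * ν * ⌈log₂ p ⌉      ∎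
  where
  open ℕ-Solver
  open ≤-Reasoning
  ν = ⌈log₂ ⌈log₂ M ⌉ ⌉

lemma3p2 : ∃ λ (C : ℕ) → ∃ λ (P₀ : ℕ) →
    ∀ (p M Y : ℕ) → Prime p → P₀ ≤ p → 3 ≤ M → M ∣ (p ∸ 1) →
    (∀ (n : ℕ) → 1 ≤ n → n < Y → IsPowerResidue M p n) →
    ⌊log₂ Y ⌋ * ⌊log₂ M ⌋ ≤ C * ⌈log₂ ⌈log₂ M ⌉ ⌉ * ⌈log₂ p ⌉
lemma3p2 = 1024 , 0 , bound
  where
  bound : ∀ p M Y → Prime p → 0 ≤ p → 3 ≤ M → M ∣ p ∸ 1 → (∀ n → 1 ≤ n → n < Y → IsPowerResidue M p n) →
          ⌊log₂ Y ⌋ * ⌊log₂ M ⌋ ≤ 1024 * ⌈log₂ ⌈log₂ M ⌉ ⌉ * ⌈log₂ p ⌉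
  bound p M Y p-prime _ 3≤M M∣p-1 residues with 41 ≤? ⌊log₂ Y ⌋
  ... | no  41≰logY = bound-for-⌊log₂Y⌋≤40 {p} {M} {Y} (≤-pred (≰⇒> 41≰logY)) 3≤M
                        (≤-trans (∣⇒≤ {{>-nonZero (m<n⇒0<n∸m (prime>1 p-prime))}} M∣p-1) (m∸n≤m p 1))
  ... | yes 41≤logY = bound-from-M≤L[k] {p} {M} {Y} 3≤M (proj₁ (proj₂ k-choice)) (proj₂ (proj₂ k-choice))
    where k-choice = M≤L[k]-for-k≲⌈log₂p⌉/⌊log₂Y⌋ p-prime M∣p-1 residues 41≤logY
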